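{- For integers $n\geqslant 0$ and $s\geqslant -1$, let $\mathcal A_{n,s}$ be the set of sequences $\sigma\in\mathbb N^n$ with $\sigma_i<i+s$ for all $i$ which avoid both $100$ and $102$, let $\mathfrak a_{n,s}=|\mathcal A_{n,s}|$, and let $\mathfrak a'_{n,s}$ be the number of $\sigma\in\mathcal A_{n,s}$ that contain the value $0$ and satisfy $\sigma_1\neq 0$. Let $\mathfrak b_{n,k}$ be the number of words of length $n$ over $\{0,\dots,k-1\}$ avoiding $102$ with all letters distinct, and $\mathfrak c_{n,k}$ the number of words $\omega$ of length $n$ over $\{0,\dots,k-1\}$ avoiding $102$ such that $\omega_i=\omega_j\neq k-1$ implies $i=j$. Then for all $n\geqslant 1$, $s\geqslant 0$, $$\mathfrak a_{n,s}=\mathfrak a_{n,s-1}+\mathfrak a_{n-1,s+1}+\mathfrak a'_{n,s},$$ $$\mathfrak a'_{n,s}=\sum_{p=2}^{n}\sum_{m=1}^{s}\Big(\mathfrak c_{n-p,m}+\sum_{r=1}^{p-2}\mathfrak a_{p-1-r,s+r-m-1}\,\mathfrak b_{n-p,m}+\sum_{r=0}^{p-2}\mathfrak a'_{p-1-r,s+r-m}\,\mathfrak b_{n-p,m-1}\Big).$$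
   Context: An integer sequence contains a pattern $\rho$ (a finite integer sequence such as $100$ or $102$) if it has a subsequence order-isomorphic to $\rho$, and avoids $\rho$ otherwise. Sequences $\sigma\in\mathbb N^n$ with $\sigma_i<i+s$ for all $i$ are called $s$-shifted inversion sequences; for $s=0$ these are the inversion sequences, so $\mathfrak a_{n,0}$ counts inversion sequences of size $n$ avoiding $100$ and $102$. For $s=-1$ the definition gives $\mathfrak a_{0,-1}=1$ and $\mathfrak a_{n,-1}=0$ for $n\geqslant1$. -}

module Defs where

open import Data.Nat using (ℕ; zero; suc; _+_; _∸_; _<_; _≟_; _<?_)
open import Data.Integer as ℤ using (ℤ; +_; -[1+_])
open import Data.Fin as Fin using (Fin; toℕ)
open import Data.Fin.Properties using (any?; all?)
import Data.Fin.Properties as FinP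
open import Data.Vec using (Vec; []; _∷_; lookup)
open import Data.List using (List; []; _∷_; map; concatMap; upTo; filter; length; applyUpTo)
open import Data.Nat.ListAction using (sum)
open import Data.Product using (_×_; _,_; ∃)
open import Relation.Binary.PropositionalEquality using (_≡_)
open import Relation.Nullary using (Dec; ¬_; _×-dec_; _→-dec_; ¬?)

seqs : (n : ℕ) → (ℕ → ℕ) → List (Vec ℕ n)
seqs zero    bnd = [] ∷ []
seqs (suc n) bnd =
  concatMap (λ x → map (x ∷_) (seqs n (λ j → bnd (suc j)))) (upTo (bnd 0))

count : {A : Set} {P : A → Set} → ((a : A) → Dec (P a)) → List A → ℕ
count P? xs = length (filter P? xs)

PairIso : ℕ → ℕ → ℕ → ℕ → Set
PairIso a b x y = (a < b → x < y) × (a ≡ b → x ≡ y) × (b < a → y < x)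

pairIso? : ∀ a b x y → Dec (PairIso a b x y)
pairIso? a b x y =
  (a <? b →-dec x <? y) ×-dec ((a ≟ b →-dec x ≟ y) ×-dec (b <? a →-dec y <? x))

TripleIso : ℕ × ℕ × ℕ → ℕ → ℕ → ℕ → Set
TripleIso (r₀ , r₁ , r₂) x₀ x₁ x₂ =
  PairIso r₀ r₁ x₀ x₁ × PairIso r₀ r₂ x₀ x₂ × PairIso r₁ r₂ x₁ x₂

tripleIso? : ∀ ρ x₀ x₁ x₂ → Dec (TripleIso ρ x₀ x₁ x₂)
tripleIso? (r₀ , r₁ , r₂) x₀ x₁ x₂ =
  pairIso? r₀ r₁ x₀ x₁ ×-dec (pairIso? r₀ r₂ x₀ x₂ ×-dec pairIso? r₁ r₂ x₁ x₂)

Contains : ∀ {n} → ℕ × ℕ × ℕ → Vec ℕ n → Set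
Contains ρ σ = ∃ λ i → ∃ λ j → ∃ λ k →
  (i Fin.< j) × (j Fin.< k) × TripleIso ρ (lookup σ i) (lookup σ j) (lookup σ k)

contains? : ∀ {n} ρ (σ : Vec ℕ n) → Dec (Contains ρ σ)
contains? ρ σ = any? λ i → any? λ j → any? λ k →
  (i FinP.<? j) ×-dec ((j FinP.<? k) ×-dec tripleIso? ρ (lookup σ i) (lookup σ j) (lookup σ k))

p100 p102 : ℕ × ℕ × ℕ
p100 = 1 , 0 , 0
p102 = 1 , 0 , 2

Avoids100-102 : ∀ {n} → Vec ℕ n → Set
Avoids100-102 σ = ¬ Contains p100 σ × ¬ Contains p102 σ

avoids100-102? : ∀ {n} (σ : Vec ℕ n) → Dec (Avoids100-102 σ)
avoids100-102? σ = ¬? (contains? p100 σ) ×-dec ¬? (contains? p102 σ)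

Avoids102 : ∀ {n} → Vec ℕ n → Set
Avoids102 σ = ¬ Contains p102 σ

-- s-shifted inversion sequences: σ_i < i + s (1-based i), entries in ℕ.
-- Since σ_i ≥ 0 this is σ_i < max(0, i + s), i.e. with 0-based j,
-- σ_j < clamp (j + 1 + s).

clamp : ℤ → ℕ
clamp (+ n)    = n
clamp -[1+ n ] = 0

shiftedBound : ℤ → ℕ → ℕ
shiftedBound s j = clamp (+ suc j ℤ.+ s)

𝔞 : ℕ → ℤ → ℕ
𝔞 n s = count avoids100-102? (seqs n (shiftedBound s))

Prime' : ∀ {n} → Vec ℕ n → Set
Prime' σ = (∃ λ i → lookup σ i ≡ 0) × (∀ i → toℕ i ≡ 0 → ¬ lookup σ i ≡ 0)

prime'? : ∀ {n} (σ : Vec ℕ n) → Dec (Prime' σ)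
prime'? σ = any? (λ i → lookup σ i ≟ 0)
  ×-dec all? (λ i → toℕ i ≟ 0 →-dec ¬? (lookup σ i ≟ 0))

𝔞′ : ℕ → ℤ → ℕ
𝔞′ n s = count (λ σ → avoids100-102? σ ×-dec prime'? σ) (seqs n (shiftedBound s))

words : (n : ℕ) → ℕ → List (Vec ℕ n)
words n k = seqs n (λ _ → k)

AllDistinct : ∀ {n} → Vec ℕ n → Set
AllDistinct ω = ∀ i j → lookup ω i ≡ lookup ω j → i ≡ j

allDistinct? : ∀ {n} (ω : Vec ℕ n) → Dec (AllDistinct ω)
allDistinct? ω = all? λ i → all? λ j → (lookup ω i ≟ lookup ω j) →-dec (i Fin.≟ j)

DistinctExceptTop : ℕ → ∀ {n} → Vec ℕ n → Set
DistinctExceptTop k ω = ∀ i j → lookup ω i ≡ lookup ω j → ¬ lookup ω i ≡ k ∸ 1 → i ≡ j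

distinctExceptTop? : ∀ k {n} (ω : Vec ℕ n) → Dec (DistinctExceptTop k ω)
distinctExceptTop? k ω = all? λ i → all? λ j →
  (lookup ω i ≟ lookup ω j) →-dec (¬? (lookup ω i ≟ k ∸ 1) →-dec (i Fin.≟ j))

𝔟 : ℕ → ℕ → ℕ
𝔟 n k = count (λ ω → ¬? (contains? p102 ω) ×-dec allDistinct? ω) (words n k)

𝔠 : ℕ → ℕ → ℕ
𝔠 n k = count (λ ω → ¬? (contains? p102 ω) ×-dec distinctExceptTop? k ω) (words n k)

-- Σ_{i=a}^{b} f i  (empty when b < a)

sumFT : ℕ → ℕ → (ℕ → ℕ) → ℕ
sumFT a b f = sum (applyUpTo (λ k → f (a + k)) (suc b ∸ a))

-- A word σ ∈ 𝒜_{n,s} either starts with 0, which takes part in no occurrence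
-- of 100 or 102 and leaves an arbitrary element of 𝒜_{n−1,s+1}; or is
-- positive, hence one more than an element of 𝒜_{n,s−1}; or lies in 𝒜′_{n,s}.
-- An element of 𝒜′_{n,s} is u 0 v with u positive of length p − 1. Since 0 is
-- the least letter, every letter of v lies in [1, m], m = min u, and the
-- remaining interaction between u and v depends only on the shape of u: either
-- u = m^(p−1), or u is a run of m's followed by letters above m, or the run is
-- followed by a larger letter and m occurs again later. In the three cases v,
-- lowered by 1, is counted by 𝔠_{n−p,m}, 𝔟_{n−p,m} and 𝔟_{n−p,m−1}, and the part
-- of u after the run, lowered by m + 1 resp. m, is an arbitrary element of 𝒜
-- resp. 𝒜′ with the shifts of the formula.

module Submission where

open import Defs
open import Algebra.Properties.CommutativeSemigroup using (interchange)
open import Data.Empty using (⊥; ⊥-elim)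
open import Data.Fin using (Fin) renaming (zero to fzero; suc to fsuc)
import Data.Fin as Fin
import Data.Fin.Properties as Fin
open import Data.List using (List; []; _∷_; _++_; map; concatMap; upTo; applyUpTo; replicate; length; take; drop)
open import Data.List.Properties
  using (map-++; map-cong; map-∘; map-upTo; map-replicate; take++drop≡id; ∷-injectiveˡ; ∷-injectiveʳ;
         ≡-dec; length-++; length-replicate)
open import Data.List.Membership.Propositional using (_∈_; _∉_)
open import Data.List.Relation.Binary.Pointwise using (Pointwise; []; _∷_)
open import Data.List.Relation.Binary.Pointwise.Properties using (Pointwise-length)
open import Data.List.Relation.Unary.All using (All; []; _∷_)
import Data.List.Relation.Unary.All as All
import Data.List.Relation.Unary.All.Properties as All
open import Data.List.Relation.Unary.Any using (Any; here; there)
import Data.List.Relation.Unary.Any as Any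
open import Data.List.Relation.Unary.Any.Properties using (++⁺ʳ)
open import Data.Nat using (ℕ; zero; suc; _+_; _*_; _∸_; _≤_; _<_; z≤n; s≤s; z<s; s<s; s<s⁻¹; _≟_; _<?_; _≤?_)
open import Data.Nat.ListAction using (sum)
open import Data.Nat.ListAction.Properties using (sum-++)
open import Data.Nat.Properties
open import Data.Product using (_×_; _,_; proj₁; proj₂; Σ; ∃)
open import Data.Sum using (_⊎_; inj₁; inj₂; [_,_]′)
import Data.Sum as Sum
open import Data.Unit using (⊤; tt)
open import Data.Vec using (Vec; toList; lookup) renaming ([] to []ᵥ; _∷_ to _∷ᵥ_)
open import Function using (_∘_; id)
open import Relation.Binary.PropositionalEquality
open import Relation.Nullary using (Dec; yes; no; ¬_; _×-dec_; _⊎-dec_; _→-dec_; ¬?)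

∑< : ℕ → (ℕ → ℕ) → ℕ
∑< zero    f = 0
∑< (suc b) f = f 0 + ∑< b (f ∘ suc)

∑<-cong : ∀ b {f g : ℕ → ℕ} → (∀ x → x < b → f x ≡ g x) → ∑< b f ≡ ∑< b g
∑<-cong zero    h = refl
∑<-cong (suc b) h = cong₂ _+_ (h 0 z<s) (∑<-cong b (λ x x<b → h (suc x) (s<s x<b)))

∑<-zero : ∀ b {f : ℕ → ℕ} → (∀ x → x < b → f x ≡ 0) → ∑< b f ≡ 0
∑<-zero zero    h = refl
∑<-zero (suc b) h = cong₂ _+_ (h 0 z<s) (∑<-zero b (λ x x<b → h (suc x) (s<s x<b)))

∑<-+ : ∀ a b (f : ℕ → ℕ) → ∑< (a + b) f ≡ ∑< a f + ∑< b (λ y → f (a + y))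
∑<-+ zero    b f = refl
∑<-+ (suc a) b f = trans (cong (f 0 +_) (∑<-+ a b (f ∘ suc))) (sym (+-assoc (f 0) _ _))

∑<-single : ∀ b t {f : ℕ → ℕ} → t < b → (∀ x → x < b → x ≢ t → f x ≡ 0) → ∑< b f ≡ f t
∑<-single (suc b) zero    {f} _ h =
  trans (cong (f 0 +_) (∑<-zero b (λ x x<b → h (suc x) (s<s x<b) (λ ())))) (+-identityʳ _)
∑<-single (suc b) (suc t) {f} (s≤s t<b) h =
  trans (cong (_+ ∑< b (f ∘ suc)) (h 0 z<s (λ ())))
        (∑<-single b t t<b (λ x x<b x≢t → h (suc x) (s<s x<b) (x≢t ∘ suc-injective)))

∑<-distrib-+ : ∀ b (f g : ℕ → ℕ) → ∑< b (λ x → f x + g x) ≡ ∑< b f + ∑< b g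
∑<-distrib-+ zero    f g = refl
∑<-distrib-+ (suc b) f g =
  trans (cong (f 0 + g 0 +_) (∑<-distrib-+ b (f ∘ suc) (g ∘ suc)))
        (interchange +-commutativeSemigroup (f 0) (g 0) (∑< b (f ∘ suc)) (∑< b (g ∘ suc)))

∑<-*ˡ : ∀ b c (f : ℕ → ℕ) → ∑< b (λ x → c * f x) ≡ c * ∑< b f
∑<-*ˡ zero    c f = sym (*-zeroʳ c)
∑<-*ˡ (suc b) c f = trans (cong (c * f 0 +_) (∑<-*ˡ b c (f ∘ suc))) (sym (*-distribˡ-+ c (f 0) _))

∑<-comm : ∀ a b (f : ℕ → ℕ → ℕ) → ∑< a (λ x → ∑< b (f x)) ≡ ∑< b (λ y → ∑< a (λ x → f x y))
∑<-comm zero    b f = sym (∑<-zero b (λ _ _ → refl))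
∑<-comm (suc a) b f =
  trans (cong (∑< b (f 0) +_) (∑<-comm a b (f ∘ suc)))
        (sym (∑<-distrib-+ b (f 0) (λ y → ∑< a (λ x → f (suc x) y))))

InBox : List ℕ → List ℕ → Set
InBox = Pointwise _<_

∑□ : List ℕ → (List ℕ → ℕ) → ℕ
∑□ []       f = f []
∑□ (b ∷ bs) f = ∑< b (λ x → ∑□ bs (λ w → f (x ∷ w)))

∑□-cong : ∀ bs {f g : List ℕ → ℕ} → (∀ w → InBox w bs → f w ≡ g w) → ∑□ bs f ≡ ∑□ bs g
∑□-cong []       h = h [] []
∑□-cong (b ∷ bs) h = ∑<-cong b (λ x x<b → ∑□-cong bs (λ w w∈ → h (x ∷ w) (x<b ∷ w∈)))

∑□-zero : ∀ bs {f : List ℕ → ℕ} → (∀ w → InBox w bs → f w ≡ 0) → ∑□ bs f ≡ 0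
∑□-zero []       h = h [] []
∑□-zero (b ∷ bs) h = ∑<-zero b (λ x x<b → ∑□-zero bs (λ w w∈ → h (x ∷ w) (x<b ∷ w∈)))

∑□-++ : ∀ bs cs (f : List ℕ → ℕ) → ∑□ (bs ++ cs) f ≡ ∑□ bs (λ u → ∑□ cs (λ v → f (u ++ v)))
∑□-++ []       cs f = refl
∑□-++ (b ∷ bs) cs f = ∑<-cong b (λ x _ → ∑□-++ bs cs (λ w → f (x ∷ w)))

∑□-distrib-+ : ∀ bs (f g : List ℕ → ℕ) → ∑□ bs (λ w → f w + g w) ≡ ∑□ bs f + ∑□ bs g
∑□-distrib-+ []       f g = refl
∑□-distrib-+ (b ∷ bs) f g =
  trans (∑<-cong b (λ x _ → ∑□-distrib-+ bs (λ w → f (x ∷ w)) (λ w → g (x ∷ w))))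
        (∑<-distrib-+ b _ _)

∑□-*ˡ : ∀ bs c (f : List ℕ → ℕ) → ∑□ bs (λ w → c * f w) ≡ c * ∑□ bs f
∑□-*ˡ []       c f = refl
∑□-*ˡ (b ∷ bs) c f = trans (∑<-cong b (λ x _ → ∑□-*ˡ bs c (λ w → f (x ∷ w)))) (∑<-*ˡ b c _)

∑□-*ʳ : ∀ bs (f : List ℕ → ℕ) c → ∑□ bs (λ w → f w * c) ≡ ∑□ bs f * c
∑□-*ʳ bs f c =
  trans (∑□-cong bs (λ w _ → *-comm (f w) c)) (trans (∑□-*ˡ bs c f) (*-comm c (∑□ bs f)))

∑□-∑< : ∀ bs n (f : ℕ → List ℕ → ℕ) → ∑□ bs (λ w → ∑< n (λ k → f k w)) ≡ ∑< n (λ k → ∑□ bs (f k))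
∑□-∑< bs zero    f = ∑□-zero bs (λ _ _ → refl)
∑□-∑< bs (suc n) f =
  trans (∑□-distrib-+ bs (f 0) (λ w → ∑< n (λ k → f (suc k) w)))
        (cong (∑□ bs (f 0) +_) (∑□-∑< bs n (f ∘ suc)))

∑□-single : ∀ bs t {f : List ℕ → ℕ} → InBox t bs → (∀ w → InBox w bs → w ≢ t → f w ≡ 0) → ∑□ bs f ≡ f t
∑□-single []       [] [] h = refl
∑□-single (b ∷ bs) (t ∷ ts) {f} (t<b ∷ ts∈) h =
  trans (∑<-single b t t<b (λ x x<b x≢t →
           ∑□-zero bs (λ w w∈ → h (x ∷ w) (x<b ∷ w∈) (x≢t ∘ ∷-injectiveˡ))))
        (∑□-single bs ts ts∈ (λ w w∈ w≢ts → h (t ∷ w) (t<b ∷ w∈) (w≢ts ∘ ∷-injectiveʳ)))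

∑□-shift : ∀ c bs (f : List ℕ → ℕ) → (∀ w → ¬ All (c ≤_) w → f w ≡ 0) →
  ∑□ (map (c +_) bs) f ≡ ∑□ bs (λ w → f (map (c +_) w))
∑□-shift c []       f h = refl
∑□-shift c (b ∷ bs) f h =
  trans (∑<-+ c b _)
    (cong₂ _+_
      (∑<-zero c (λ x x<c → ∑□-zero (map (c +_) bs) (λ w _ → h (x ∷ w) (λ { (c≤x ∷ _) → <⇒≱ x<c c≤x }))))
      (∑<-cong b (λ y _ → ∑□-shift c bs (λ w → f (c + y ∷ w)) (λ w ¬w≥c → h (c + y ∷ w) (λ { (_ ∷ w≥c) → ¬w≥c w≥c })))))

∑□-restrict : ∀ bs cs (f : List ℕ → ℕ) → Pointwise _≤_ bs cs →
  (∀ w → InBox w cs → ¬ InBox w bs → f w ≡ 0) → ∑□ cs f ≡ ∑□ bs f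
∑□-restrict []       []       f []           h = refl
∑□-restrict (b ∷ bs) (c ∷ cs) f (b≤c ∷ bs≤cs) h = begin
  ∑< c g                                  ≡⟨ cong (λ k → ∑< k g) (sym (m+[n∸m]≡n b≤c)) ⟩
  ∑< (b + (c ∸ b)) g                      ≡⟨ ∑<-+ b (c ∸ b) g ⟩
  ∑< b g + ∑< (c ∸ b) (λ y → g (b + y))   ≡⟨ cong₂ _+_ (∑<-cong b below) (∑<-zero (c ∸ b) above) ⟩
  ∑< b (λ x → ∑□ bs (λ w → f (x ∷ w))) + 0 ≡⟨ +-identityʳ _ ⟩
  ∑□ (b ∷ bs) f                           ∎
  where
  open ≡-Reasoning
  g : ℕ → ℕ
  g x = ∑□ cs (λ w → f (x ∷ w))
  below : ∀ x → x < b → g x ≡ ∑□ bs (λ w → f (x ∷ w))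
  below x x<b = ∑□-restrict bs cs (λ w → f (x ∷ w)) bs≤cs
    (λ w w∈cs w∉bs → h (x ∷ w) (≤-trans x<b b≤c ∷ w∈cs) (λ { (_ ∷ w∈bs) → w∉bs w∈bs }))
  above : ∀ y → y < c ∸ b → g (b + y) ≡ 0
  above y y<c∸b = ∑□-zero cs (λ w w∈cs →
    h (b + y ∷ w) (subst (b + y <_) (m+[n∸m]≡n b≤c) (+-monoʳ-< b y<c∸b) ∷ w∈cs) (λ { (b+y<b ∷ _) → m+n≮m b y b+y<b }))

infix 3 _⇔_
_⇔_ : Set → Set → Set
A ⇔ B = (A → B) × (B → A)

_×-⇔_ : ∀ {A B C D : Set} → A ⇔ C → B ⇔ D → (A × B) ⇔ (C × D)
(f , f⁻) ×-⇔ (g , g⁻) = (λ { (a , b) → f a , g b }) , (λ { (c , d) → f⁻ c , g⁻ d })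

_⊎-⇔_ : ∀ {A B C D : Set} → A ⇔ C → B ⇔ D → (A ⊎ B) ⇔ (C ⊎ D)
(f , f⁻) ⊎-⇔ (g , g⁻) = [ inj₁ ∘ f , inj₂ ∘ g ]′ , [ inj₁ ∘ f⁻ , inj₂ ∘ g⁻ ]′

¬-⇔ : ∀ {A B : Set} → A ⇔ B → (¬ A) ⇔ (¬ B)
¬-⇔ (f , f⁻) = (λ ¬a → ¬a ∘ f⁻) , (λ ¬b → ¬b ∘ f)

All-⇔ : ∀ {P Q : ℕ → Set} {w} → All (λ z → P z ⇔ Q z) w → All P w ⇔ All Q w
All-⇔ []              = (λ _ → []) , (λ _ → [])
All-⇔ ((f , f⁻) ∷ hs) =
  (λ { (p ∷ ps) → f p ∷ proj₁ (All-⇔ hs) ps }) , (λ { (q ∷ qs) → f⁻ q ∷ proj₂ (All-⇔ hs) qs })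

_∘⇔_ : ∀ {A B C : Set} → B ⇔ C → A ⇔ B → A ⇔ C
(g , g⁻) ∘⇔ (f , f⁻) = g ∘ f , f⁻ ∘ g⁻

All-map-⇔ : ∀ {P : ℕ → Set} (f : ℕ → ℕ) w → All P (map f w) ⇔ All (P ∘ f) w
All-map-⇔ f w = All.map⁻ , All.map⁺

𝟙 : {A : Set} → Dec A → ℕ
𝟙 (yes _) = 1
𝟙 (no _)  = 0

𝟙-cong : ∀ {A B : Set} (a : Dec A) (b : Dec B) → A ⇔ B → 𝟙 a ≡ 𝟙 b
𝟙-cong (yes _) (yes _) _       = refl
𝟙-cong (yes a) (no ¬b) (f , _) = ⊥-elim (¬b (f a))
𝟙-cong (no ¬a) (yes b) (_ , g) = ⊥-elim (¬a (g b))
𝟙-cong (no _)  (no _)  _       = refl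

𝟙-no : ∀ {A : Set} (a : Dec A) → ¬ A → 𝟙 a ≡ 0
𝟙-no (yes a) ¬a = ⊥-elim (¬a a)
𝟙-no (no _)  _  = refl

𝟙-yes : ∀ {A : Set} (a : Dec A) → A → 𝟙 a ≡ 1
𝟙-yes (yes _) _ = refl
𝟙-yes (no ¬a) a = ⊥-elim (¬a a)

𝟙-× : ∀ {P A B : Set} (p : Dec P) (a : Dec A) (b : Dec B) → P ⇔ (A × B) → 𝟙 p ≡ 𝟙 a * 𝟙 b
𝟙-× p (yes a) (yes b) (_ , g) = 𝟙-yes p (g (a , b))
𝟙-× p (yes _) (no ¬b) (f , _) = 𝟙-no p (¬b ∘ proj₂ ∘ f)
𝟙-× p (no ¬a) _       (f , _) = 𝟙-no p (¬a ∘ proj₁ ∘ f)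

𝟙-⊎ : ∀ {P A B : Set} (p : Dec P) (a : Dec A) (b : Dec B) →
  P ⇔ (A ⊎ B) → ¬ (A × B) → 𝟙 p ≡ 𝟙 a + 𝟙 b
𝟙-⊎ p (yes a) (yes b) _       disj = ⊥-elim (disj (a , b))
𝟙-⊎ p (yes a) (no _)  (_ , g) _    = 𝟙-yes p (g (inj₁ a))
𝟙-⊎ p (no _)  (yes b) (_ , g) _    = 𝟙-yes p (g (inj₂ b))
𝟙-⊎ p (no ¬a) (no ¬b) (f , _) _    = 𝟙-no p (λ x → [ ¬a , ¬b ]′ (f x))

𝟙-guard : ∀ {A : Set} (a : Dec A) {x y : ℕ} → (A → x ≡ y) → 𝟙 a * x ≡ 𝟙 a * y
𝟙-guard (yes a) x≡y = cong (1 *_) (x≡y a)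
𝟙-guard (no _)  _   = refl

count-as-sum : ∀ {A : Set} {P : A → Set} (P? : ∀ a → Dec (P a)) (xs : List A) →
  count P? xs ≡ sum (map (𝟙 ∘ P?) xs)
count-as-sum P? []       = refl
count-as-sum P? (x ∷ xs) with P? x
... | yes _ = cong suc (count-as-sum P? xs)
... | no _  = count-as-sum P? xs

sum-map-concatMap : ∀ {A B : Set} (h : B → ℕ) (k : A → List B) (xs : List A) →
  sum (map h (concatMap k xs)) ≡ sum (map (λ x → sum (map h (k x))) xs)
sum-map-concatMap h k []       = refl
sum-map-concatMap h k (x ∷ xs) =
  trans (cong sum (map-++ h (k x) (concatMap k xs)))
        (trans (sum-++ (map h (k x)) _) (cong (sum (map h (k x)) +_) (sum-map-concatMap h k xs)))

sum-applyUpTo : ∀ (h : ℕ → ℕ) b → sum (applyUpTo h b) ≡ ∑< b h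
sum-applyUpTo h zero    = refl
sum-applyUpTo h (suc b) = cong (h 0 +_) (sum-applyUpTo (h ∘ suc) b)

sum-seqs : ∀ n (bnd : ℕ → ℕ) (g : List ℕ → ℕ) →
  sum (map (g ∘ toList) (seqs n bnd)) ≡ ∑□ (applyUpTo bnd n) g
sum-seqs zero    bnd g = +-identityʳ _
sum-seqs (suc n) bnd g =
  trans (sum-map-concatMap (g ∘ toList) _ (upTo (bnd 0)))
    (trans (trans (cong sum (map-upTo _ (bnd 0))) (sum-applyUpTo _ (bnd 0)))
      (∑<-cong (bnd 0) (λ x _ →
        trans (cong sum (sym (map-∘ (seqs n (bnd ∘ suc)))))
              (sum-seqs n (bnd ∘ suc) (λ w → g (x ∷ w))))))

count-seqs : ∀ n (bnd : ℕ → ℕ) {P : Vec ℕ n → Set} (P? : ∀ σ → Dec (P σ))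
  {Q : List ℕ → Set} (Q? : ∀ w → Dec (Q w)) → (∀ σ → P σ ⇔ Q (toList σ)) →
  count P? (seqs n bnd) ≡ ∑□ (applyUpTo bnd n) (𝟙 ∘ Q?)
count-seqs n bnd P? Q? P⇔Q =
  trans (count-as-sum P? (seqs n bnd))
    (trans (cong sum (map-cong (λ σ → 𝟙-cong (P? σ) (Q? (toList σ)) (P⇔Q σ)) (seqs n bnd)))
           (sum-seqs n bnd (𝟙 ∘ Q?)))

Ternary : Set₁
Ternary = ℕ → ℕ → ℕ → Set

NoTripleFrom : Ternary → ℕ → List ℕ → Set
NoTripleFrom R x []      = ⊤
NoTripleFrom R x (y ∷ w) = All (¬_ ∘ R x y) w × NoTripleFrom R x w

TripleFree : Ternary → List ℕ → Set
TripleFree R []      = ⊤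
TripleFree R (x ∷ w) = NoTripleFrom R x w × TripleFree R w

noTripleFrom? : ∀ {R} → (∀ x y z → Dec (R x y z)) → ∀ x w → Dec (NoTripleFrom R x w)
noTripleFrom? R? x []      = yes tt
noTripleFrom? R? x (y ∷ w) = All.all? (λ z → ¬? (R? x y z)) w ×-dec noTripleFrom? R? x w

tripleFree? : ∀ {R} → (∀ x y z → Dec (R x y z)) → ∀ w → Dec (TripleFree R w)
tripleFree? R? []      = yes tt
tripleFree? R? (x ∷ w) = noTripleFrom? R? x w ×-dec tripleFree? R? w

NoTriple : Ternary → ∀ {n} → Vec ℕ n → Set
NoTriple R σ = ∀ i j k → i Fin.< j → j Fin.< k → ¬ R (lookup σ i) (lookup σ j) (lookup σ k)

All-toList : ∀ {n} {P : ℕ → Set} (τ : Vec ℕ n) → (∀ k → P (lookup τ k)) ⇔ All P (toList τ)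
All-toList []ᵥ      = (λ _ → []) , (λ _ ())
All-toList (x ∷ᵥ τ) =
  (λ h → h fzero ∷ proj₁ (All-toList τ) (h ∘ fsuc)) ,
  (λ { (p ∷ _) fzero → p ; (_ ∷ ps) (fsuc k) → proj₂ (All-toList τ) ps k })

Any-toList : ∀ {n} {P : ℕ → Set} (τ : Vec ℕ n) → (∃ λ k → P (lookup τ k)) ⇔ Any P (toList τ)
Any-toList []ᵥ      = (λ { (() , _) }) , (λ ())
Any-toList (x ∷ᵥ τ) =
  (λ { (fzero , p) → here p ; (fsuc k , p) → there (proj₁ (Any-toList τ) (k , p)) }) ,
  (λ { (here p) → fzero , p ; (there a) → let (k , p) = proj₂ (Any-toList τ) a in fsuc k , p })

noTripleFrom-toList : ∀ {R} x {n} (τ : Vec ℕ n) →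
  (∀ j k → j Fin.< k → ¬ R x (lookup τ j) (lookup τ k)) ⇔ NoTripleFrom R x (toList τ)
noTripleFrom-toList x []ᵥ      = (λ _ → tt) , (λ _ ())
noTripleFrom-toList x (y ∷ᵥ τ) =
  (λ h → proj₁ (All-toList τ) (λ k → h fzero (fsuc k) z<s) ,
         proj₁ (noTripleFrom-toList x τ) (λ j k j<k → h (fsuc j) (fsuc k) (s<s j<k))) ,
  (λ { (a , _) fzero    (fsuc k) _         → proj₂ (All-toList τ) a k
     ; (_ , g) (fsuc j) (fsuc k) (s<s j<k) → proj₂ (noTripleFrom-toList x τ) g j k j<k })

tripleFree-toList : ∀ {R n} (σ : Vec ℕ n) → NoTriple R σ ⇔ TripleFree R (toList σ)
tripleFree-toList []ᵥ      = (λ _ → tt) , (λ _ ())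
tripleFree-toList (x ∷ᵥ τ) =
  (λ h → proj₁ (noTripleFrom-toList x τ) (λ j k j<k → h fzero (fsuc j) (fsuc k) z<s (s<s j<k)) ,
         proj₁ (tripleFree-toList τ) (λ i j k i<j j<k → h (fsuc i) (fsuc j) (fsuc k) (s<s i<j) (s<s j<k))) ,
  (λ { (g , _) fzero    (fsuc j) (fsuc k) _         (s<s j<k) → proj₂ (noTripleFrom-toList x τ) g j k j<k
     ; (_ , a) (fsuc i) (fsuc j) (fsuc k) (s<s i<j) (s<s j<k) → proj₂ (tripleFree-toList τ) a i j k i<j j<k })

Pattern100∨102 : Ternary
Pattern100∨102 x y z = y < x × (z ≡ y ⊎ x < z)

Pattern102 : Ternary
Pattern102 x y z = y < x × x < z

Free Free102 : List ℕ → Set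
Free    = TripleFree Pattern100∨102
Free102 = TripleFree Pattern102

free? : ∀ w → Dec (Free w)
free? = tripleFree? (λ x y z → (y <? x) ×-dec ((z ≟ y) ⊎-dec (x <? z)))

free102? : ∀ w → Dec (Free102 w)
free102? = tripleFree? (λ x y z → (y <? x) ×-dec (x <? z))

iso100⇔ : ∀ x y z → TripleIso p100 x y z ⇔ (y < x × z ≡ y)
iso100⇔ x y z =
  (λ { ((_ , _ , y<x) , _ , (_ , z≡y , _)) → y<x z<s , sym (z≡y refl) }) ,
  (λ { (y<x , refl) → ((λ ()) , (λ ()) , λ _ → y<x) , ((λ ()) , (λ ()) , λ _ → y<x) , ((λ ()) , (λ _ → refl) , (λ ())) })

iso102⇔ : ∀ x y z → TripleIso p102 x y z ⇔ Pattern102 x y z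
iso102⇔ x y z =
  (λ { ((_ , _ , y<x) , (x<z , _ , _) , _) → y<x z<s , x<z (s<s z<s) }) ,
  (λ { (y<x , x<z) → ((λ ()) , (λ ()) , λ _ → y<x) , ((λ _ → x<z) , (λ ()) , λ { (s<s ()) })
                   , ((λ _ → <-trans y<x x<z) , (λ ()) , λ ()) })

avoids100-102⇔ : ∀ {n} (σ : Vec ℕ n) → Avoids100-102 σ ⇔ Free (toList σ)
avoids100-102⇔ σ =
  (λ { (¬100 , ¬102) → proj₁ (tripleFree-toList σ) λ where
         i j k i<j j<k (y<x , inj₁ z≡y) → ¬100 (i , j , k , i<j , j<k , proj₂ (iso100⇔ _ _ _) (y<x , z≡y))
         i j k i<j j<k (y<x , inj₂ x<z) → ¬102 (i , j , k , i<j , j<k , proj₂ (iso102⇔ _ _ _) (y<x , x<z)) }) ,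
  (λ free → let noTriple = proj₂ (tripleFree-toList σ) free in
    (λ { (i , j , k , i<j , j<k , t) → let (y<x , z≡y) = proj₁ (iso100⇔ _ _ _) t in noTriple i j k i<j j<k (y<x , inj₁ z≡y) }) ,
    (λ { (i , j , k , i<j , j<k , t) → let (y<x , x<z) = proj₁ (iso102⇔ _ _ _) t in noTriple i j k i<j j<k (y<x , inj₂ x<z) }))

avoids102⇔ : ∀ {n} (σ : Vec ℕ n) → Avoids102 σ ⇔ Free102 (toList σ)
avoids102⇔ σ =
  (λ ¬102 → proj₁ (tripleFree-toList σ) (λ i j k i<j j<k p → ¬102 (i , j , k , i<j , j<k , proj₂ (iso102⇔ _ _ _) p))) ,
  (λ free (i , j , k , i<j , j<k , t) → proj₂ (tripleFree-toList σ) free i j k i<j j<k (proj₁ (iso102⇔ _ _ _) t))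

UniqueOn : (ℕ → Set) → List ℕ → Set
UniqueOn Q []      = ⊤
UniqueOn Q (x ∷ w) = (Q x → All (_≢ x) w) × UniqueOn Q w

uniqueOn? : ∀ {Q} → (∀ x → Dec (Q x)) → ∀ w → Dec (UniqueOn Q w)
uniqueOn? Q? []      = yes tt
uniqueOn? Q? (x ∷ w) = (Q? x →-dec All.all? (λ z → ¬? (z ≟ x)) w) ×-dec uniqueOn? Q? w

Distinct : List ℕ → Set
Distinct = UniqueOn (λ _ → ⊤)

distinct? : ∀ w → Dec (Distinct w)
distinct? = uniqueOn? (λ _ → yes tt)

uniqueOn-toList : ∀ {Q : ℕ → Set} {n} (ω : Vec ℕ n) →
  (∀ i j → lookup ω i ≡ lookup ω j → Q (lookup ω i) → i ≡ j) ⇔ UniqueOn Q (toList ω)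
uniqueOn-toList []ᵥ = (λ _ → tt) , (λ _ ())
uniqueOn-toList {Q} (x ∷ᵥ ω) =
  (λ h → (λ q → proj₁ (All-toList ω) (λ k e → fzero≢fsuc (h fzero (fsuc k) (sym e) q))) ,
         proj₁ (uniqueOn-toList ω) (λ i j e q → Fin.suc-injective (h (fsuc i) (fsuc j) e q))) ,
  λ where
    (a , r) fzero    fzero    e q → refl
    (a , r) fzero    (fsuc j) e q → ⊥-elim (proj₂ (All-toList ω) (a q) j (sym e))
    (a , r) (fsuc i) fzero    e q → ⊥-elim (proj₂ (All-toList ω) (a (subst Q e q)) i e)
    (a , r) (fsuc i) (fsuc j) e q → cong fsuc (proj₂ (uniqueOn-toList ω) r i j e q)
  where
  fzero≢fsuc : ∀ {n} {k : Fin n} → fzero ≢ fsuc k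
  fzero≢fsuc ()

allDistinct⇔ : ∀ {n} (ω : Vec ℕ n) → AllDistinct ω ⇔ Distinct (toList ω)
allDistinct⇔ ω =
  (λ h → proj₁ (uniqueOn-toList ω) (λ i j e _ → h i j e)) ,
  (λ d i j e → proj₂ (uniqueOn-toList ω) d i j e tt)

distinctExceptTop⇔ : ∀ k {n} (ω : Vec ℕ n) → DistinctExceptTop k ω ⇔ UniqueOn (_≢ k ∸ 1) (toList ω)
distinctExceptTop⇔ k ω = uniqueOn-toList ω

Primed : List ℕ → Set
Primed []      = ⊥
Primed (x ∷ w) = x ≢ 0 × Any (_≡ 0) w

primed? : ∀ w → Dec (Primed w)
primed? []      = no (λ ())
primed? (x ∷ w) = ¬? (x ≟ 0) ×-dec Any.any? (_≟ 0) w

prime′⇔ : ∀ {n} (σ : Vec ℕ n) → Prime' σ ⇔ Primed (toList σ)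
prime′⇔ []ᵥ = (λ { ((() , _) , _) }) , (λ ())
prime′⇔ (x ∷ᵥ τ) =
  (λ { ((fzero , e) , h) → ⊥-elim (h fzero refl e)
     ; ((fsuc k , e) , h) → h fzero refl , proj₁ (Any-toList τ) (k , e) }) ,
  (λ { (x≢0 , a) → let (k , p) = proj₂ (Any-toList τ) a in (fsuc k , p) , λ { fzero _ → x≢0 ; (fsuc i) () } })

ShiftInvariant : Ternary → ℕ → Set
ShiftInvariant R c = ∀ x y z → R (c + x) (c + y) (c + z) ⇔ R x y z

noTripleFrom-shift : ∀ {R c} → ShiftInvariant R c → ∀ x w → NoTripleFrom R (c + x) (map (c +_) w) ⇔ NoTripleFrom R x w
noTripleFrom-shift inv x []      = (λ _ → tt) , (λ _ → tt)
noTripleFrom-shift {R} {c} inv x (y ∷ w) =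
  (All-⇔ (All.universal (λ z → ¬-⇔ (inv x y z)) w) ∘⇔ All-map-⇔ (c +_) w) ×-⇔ noTripleFrom-shift inv x w

tripleFree-shift : ∀ {R c} → ShiftInvariant R c → ∀ w → TripleFree R (map (c +_) w) ⇔ TripleFree R w
tripleFree-shift inv []      = (λ _ → tt) , (λ _ → tt)
tripleFree-shift inv (x ∷ w) = noTripleFrom-shift inv x w ×-⇔ tripleFree-shift inv w

<-shift : ∀ c {x y} → (c + x < c + y) ⇔ (x < y)
<-shift c = +-cancelˡ-< c _ _ , +-monoʳ-< c

≡-shift : ∀ c {x y} → (c + x ≡ c + y) ⇔ (x ≡ y)
≡-shift c = +-cancelˡ-≡ c _ _ , cong (c +_)

pattern100∨102-shift : ∀ c → ShiftInvariant Pattern100∨102 c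
pattern100∨102-shift c x y z = <-shift c ×-⇔ (≡-shift c ⊎-⇔ <-shift c)

pattern102-shift : ∀ c → ShiftInvariant Pattern102 c
pattern102-shift c x y z = <-shift c ×-⇔ <-shift c

uniqueOn-shift : ∀ {Q : ℕ → Set} c w → UniqueOn Q (map (c +_) w) ⇔ UniqueOn (Q ∘ (c +_)) w
uniqueOn-shift c []      = (λ _ → tt) , (λ _ → tt)
uniqueOn-shift c (x ∷ w) =
  ((λ f q → All.map (λ ne → ne ∘ cong (c +_)) (All.map⁻ (f q))) ,
   (λ f q → All.map⁺ (All.map (λ ne → ne ∘ +-cancelˡ-≡ c _ _) (f q))))
  ×-⇔ uniqueOn-shift c w

noTripleFrom-++ : ∀ R x u v →
  NoTripleFrom R x (u ++ v) ⇔ (NoTripleFrom R x u × All (λ y → All (¬_ ∘ R x y) v) u × NoTripleFrom R x v)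
noTripleFrom-++ R x []      v = (λ g → tt , [] , g) , (λ { (_ , _ , g) → g })
noTripleFrom-++ R x (y ∷ u) v =
  (λ { (a , g) → let (a₁ , a₂) = All.++⁻ u a ; (g₁ , c₁ , g₂) = proj₁ (noTripleFrom-++ R x u v) g
                 in (a₁ , g₁) , (a₂ ∷ c₁) , g₂ }) ,
  (λ { ((a₁ , g₁) , (a₂ ∷ c₁) , g₂) → All.++⁺ a₁ a₂ , proj₂ (noTripleFrom-++ R x u v) (g₁ , c₁ , g₂) })

Across : Ternary → List ℕ → List ℕ → Set
Across R []      v = ⊤
Across R (x ∷ u) v = All (λ y → All (¬_ ∘ R x y) v) u × NoTripleFrom R x v × Across R u v

tripleFree-++ : ∀ R u v → TripleFree R (u ++ v) ⇔ (TripleFree R u × Across R u v × TripleFree R v)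
tripleFree-++ R []      v = (λ a → tt , tt , a) , (λ { (_ , _ , a) → a })
tripleFree-++ R (x ∷ u) v =
  (λ { (g , a) → let (g₁ , c₁ , g₂) = proj₁ (noTripleFrom-++ R x u v) g ; (a₁ , x₁ , a₂) = proj₁ (tripleFree-++ R u v) a
                 in (g₁ , a₁) , (c₁ , g₂ , x₁) , a₂ }) ,
  (λ { ((g₁ , a₁) , (c₁ , g₂ , x₁) , a₂) →
       proj₂ (noTripleFrom-++ R x u v) (g₁ , c₁ , g₂) , proj₂ (tripleFree-++ R u v) (a₁ , x₁ , a₂) })

free-0∷ : ∀ w → Free (0 ∷ w) ⇔ Free w
free-0∷ w = proj₂ , (λ a → noTripleFrom0 w , a)
  where
  noTripleFrom0 : ∀ w → NoTripleFrom Pattern100∨102 0 w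
  noTripleFrom0 []      = tt
  noTripleFrom0 (y ∷ w) = All.universal (λ { z (() , _) }) w , noTripleFrom0 w

Within : ℕ → ℕ → Set
Within x z = 0 < z × z ≤ x

AcrossZero : List ℕ → List ℕ → Set
AcrossZero []      v = ⊤
AcrossZero (x ∷ u) v =
  All (λ y → All (¬_ ∘ Pattern100∨102 x y) v) u × (All (Within x) v × NoTripleFrom Pattern100∨102 x v) × AcrossZero u v

across-zero⇔ : ∀ u v → All (0 <_) u → Across Pattern100∨102 u (0 ∷ v) ⇔ AcrossZero u v
across-zero⇔ []      v _           = (λ _ → tt) , (λ _ → tt)
across-zero⇔ (x ∷ u) v (0<x ∷ 0<u) =
  All-⇔ (All.map (λ 0<y → (λ { (_ ∷ a) → a }) , (¬to0 0<y ∷_)) 0<u)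
  ×-⇔ ((All-⇔ (All.universal (λ z → ¬via0⇔ z) v) ×-⇔ (id , id)) ×-⇔ across-zero⇔ u v 0<u)
  where
  ¬to0 : ∀ {y} → 0 < y → ¬ Pattern100∨102 x y 0
  ¬to0 0<y (_ , inj₁ 0≡y) = <⇒≢ 0<y 0≡y
  ¬to0 0<y (_ , inj₂ ())
  ¬via0⇔ : ∀ z → (¬ Pattern100∨102 x 0 z) ⇔ Within x z
  ¬via0⇔ zero    = (λ ¬p → ⊥-elim (¬p (0<x , inj₁ refl))) , (λ { (() , _) })
  ¬via0⇔ (suc z) = (λ ¬p → z<s , ≮⇒≥ (λ x<z → ¬p (0<x , inj₂ x<z))) ,
                   (λ { _ (_ , inj₁ ()) ; (_ , z≤x) (_ , inj₂ x<z) → <⇒≱ x<z z≤x })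

free-split-at-zero : ∀ u v → All (0 <_) u → Free (u ++ 0 ∷ v) ⇔ (Free u × AcrossZero u v × Free v)
free-split-at-zero u v 0<u =
  (λ a → let (a₁ , x₁ , a₂) = proj₁ (tripleFree-++ _ u (0 ∷ v)) a
         in a₁ , proj₁ (across-zero⇔ u v 0<u) x₁ , proj₁ (free-0∷ v) a₂) ,
  (λ { (a₁ , x₁ , a₂) → proj₂ (tripleFree-++ _ u (0 ∷ v)) (a₁ , proj₂ (across-zero⇔ u v 0<u) x₁ , proj₂ (free-0∷ v) a₂) })

uniqueOn-mono : ∀ {Q Q′ : ℕ → Set} w → All (λ z → Q′ z → Q z) w → UniqueOn Q w → UniqueOn Q′ w
uniqueOn-mono []      _        _       = tt
uniqueOn-mono (x ∷ w) (h ∷ hs) (f , n) = f ∘ h , uniqueOn-mono w hs n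

distinct⇒uniqueOn : ∀ {Q : ℕ → Set} w → Distinct w → UniqueOn Q w
distinct⇒uniqueOn w = uniqueOn-mono w (All.universal _ w)

noTripleFrom-100∨102⇔ : ∀ x w →
  NoTripleFrom Pattern100∨102 x w ⇔ (NoTripleFrom Pattern102 x w × UniqueOn (_< x) w)
noTripleFrom-100∨102⇔ x []      = (λ _ → tt , tt) , (λ _ → tt)
noTripleFrom-100∨102⇔ x (y ∷ w) =
  (λ { (a , g) → let (g₁ , n₁) = proj₁ (noTripleFrom-100∨102⇔ x w) g in
         (All.map (λ ¬p (y<x , x<z) → ¬p (y<x , inj₂ x<z)) a , g₁) ,
         ((λ y<x → All.map (λ ¬p z≡y → ¬p (y<x , inj₁ z≡y)) a) , n₁) }) ,
  (λ { ((a , g₁) , (f , n₁)) → combine a f , proj₂ (noTripleFrom-100∨102⇔ x w) (g₁ , n₁) })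
  where
  combine : All (¬_ ∘ Pattern102 x y) w → (y < x → All (_≢ y) w) → All (¬_ ∘ Pattern100∨102 x y) w
  combine a f with y <? x
  ... | no  y≮x = All.universal (λ z p → y≮x (proj₁ p)) w
  ... | yes y<x = All.zipWith (λ { (¬p , _) (y<x , inj₂ x<z) → ¬p (y<x , x<z) ; (_ , z≢y) (_ , inj₁ z≡y) → z≢y z≡y })
                              (a , f y<x)

-- Avoiding 100: for every letter, the later letters below it are distinct.
No100 : List ℕ → Set
No100 []      = ⊤
No100 (x ∷ w) = UniqueOn (_< x) w × No100 w

free⇔free102×no100 : ∀ w → Free w ⇔ (Free102 w × No100 w)
free⇔free102×no100 []      = (λ _ → tt , tt) , (λ _ → tt)
free⇔free102×no100 (x ∷ w) =
  (λ { (g , a) → let (g₁ , n₁) = proj₁ (noTripleFrom-100∨102⇔ x w) g ; (a₁ , m₁) = proj₁ (free⇔free102×no100 w) a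
                 in (g₁ , a₁) , (n₁ , m₁) }) ,
  (λ { ((g₁ , a₁) , (n₁ , m₁)) → proj₂ (noTripleFrom-100∨102⇔ x w) (g₁ , n₁) , proj₂ (free⇔free102×no100 w) (a₁ , m₁) })

no100-bounded : ∀ M w → All (_≤ M) w → UniqueOn (_< M) w → No100 w
no100-bounded M []      _          _       = tt
no100-bounded M (x ∷ w) (x≤M ∷ hs) (_ , n) =
  uniqueOn-mono w (All.universal (λ z z<x → <-≤-trans z<x x≤M) w) n , no100-bounded M w hs n

no100-distinct : ∀ w → Distinct w → No100 w
no100-distinct []      _       = tt
no100-distinct (x ∷ w) (_ , n) = distinct⇒uniqueOn w n , no100-distinct w n

noTripleFrom102-bounded : ∀ x w → All (_≤ x) w → NoTripleFrom Pattern102 x w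
noTripleFrom102-bounded x []      _          = tt
noTripleFrom102-bounded x (y ∷ w) (_ ∷ w≤x) = All.map (λ z≤x p → <⇒≱ (proj₂ p) z≤x) w≤x , noTripleFrom102-bounded x w w≤x

noTripleFrom-bounded⇔ : ∀ x w → All (_≤ x) w → NoTripleFrom Pattern100∨102 x w ⇔ UniqueOn (_< x) w
noTripleFrom-bounded⇔ x w w≤x =
  proj₂ ∘ proj₁ (noTripleFrom-100∨102⇔ x w) ,
  (λ n → proj₂ (noTripleFrom-100∨102⇔ x w) (noTripleFrom102-bounded x w w≤x , n))

acrossZero-lookup : ∀ u v {x} → AcrossZero u v → x ∈ u → All (Within x) v × NoTripleFrom Pattern100∨102 x v
acrossZero-lookup (y ∷ u) v (_ , p , _) (here refl) = p
acrossZero-lookup (y ∷ u) v (_ , _ , r) (there x∈u) = acrossZero-lookup u v r x∈u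

noPatternFromMin : ∀ M w v → All (M ≤_) w → All (λ y → All (¬_ ∘ Pattern100∨102 M y) v) w
noPatternFromMin M w v M≤w = All.map (λ M≤y → All.universal (λ z p → <⇒≱ (proj₁ p) M≤y) v) M≤w

replicate-++-≥ : ∀ M r rest → All (M ≤_) rest → All (M ≤_) (replicate r M ++ rest)
replicate-++-≥ M zero    rest h = h
replicate-++-≥ M (suc r) rest h = ≤-refl ∷ replicate-++-≥ M r rest h

acrossZero-run : ∀ M r rest v → All (M ≤_) rest →
  AcrossZero (replicate (suc r) M ++ rest) v ⇔ ((All (Within M) v × NoTripleFrom Pattern100∨102 M v) × AcrossZero rest v)
acrossZero-run M zero    rest v h = (λ { (_ , p , x) → p , x }) , (λ { (p , x) → noPatternFromMin M rest v h , p , x })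
acrossZero-run M (suc r) rest v h =
  (λ { (_ , p , x) → p , proj₂ (proj₁ (acrossZero-run M r rest v h) x) }) ,
  (λ { (p , x) → noPatternFromMin M _ v (replicate-++-≥ M (suc r) rest h) , p , proj₂ (acrossZero-run M r rest v h) (p , x) })

acrossZero-above : ∀ B u v → All (B <_) u → All (Within B) v → Distinct v → AcrossZero u v
acrossZero-above B []      v _            _  _ = tt
acrossZero-above B (x ∷ u) v (B<x ∷ B<u) v≤B dv =
  All.map (λ B<y → All.map (λ { (_ , z≤B) (_ , inj₁ z≡y) → <⇒≢ (≤-<-trans z≤B B<y) z≡y
                                ; (_ , z≤B) (_ , inj₂ x<z) → <⇒≱ x<z (≤-trans z≤B (<⇒≤ B<x)) }) v≤B) B<u ,
  (v≤x , proj₂ (noTripleFrom-bounded⇔ x v (All.map proj₂ v≤x)) (distinct⇒uniqueOn v dv)) ,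
  acrossZero-above B u v B<u v≤B dv
  where
  v≤x : All (Within x) v
  v≤x = All.map (λ { (0<z , z≤B) → 0<z , ≤-trans z≤B (<⇒≤ B<x) }) v≤B

free-run-++ : ∀ M r rest → All (M ≤_) rest → Free (replicate r M ++ rest) ⇔ Free rest
free-run-++ M zero    rest h = id , id
free-run-++ M (suc r) rest h =
  (λ { (_ , a) → proj₁ (free-run-++ M r rest h) a }) ,
  (λ a → noTripleFromMin (replicate r M ++ rest) (replicate-++-≥ M r rest h) , proj₂ (free-run-++ M r rest h) a)
  where
  noTripleFromMin : ∀ w → All (M ≤_) w → NoTripleFrom Pattern100∨102 M w
  noTripleFromMin []      _          = tt
  noTripleFromMin (y ∷ w) (M≤y ∷ hs) = All.universal (λ z p → <⇒≱ (proj₁ p) M≤y) w , noTripleFromMin w hs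

tailCondition-allMin : ∀ M r v →
  (AcrossZero (replicate (suc r) M ++ []) v × Free v) ⇔ (All (Within M) v × Free102 v × UniqueOn (_< M) v)
tailCondition-allMin M r v =
  (λ { (x , a) → let ((p , g) , _) = proj₁ (acrossZero-run M r [] v []) x
                 in p , proj₁ (proj₁ (free⇔free102×no100 v) a) , proj₁ (noTripleFrom-bounded⇔ M v (All.map proj₂ p)) g }) ,
  (λ { (p , a , n) → let v≤M = All.map proj₂ p in
       proj₂ (acrossZero-run M r [] v []) ((p , proj₂ (noTripleFrom-bounded⇔ M v v≤M) n) , tt) ,
       proj₂ (free⇔free102×no100 v) (a , no100-bounded M v v≤M n) })

tailCondition-minThenAbove : ∀ M r y rest v → All (M <_) (y ∷ rest) →
  (AcrossZero (replicate (suc r) M ++ y ∷ rest) v × Free v) ⇔ (All (Within M) v × Free102 v × Distinct v)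
tailCondition-minThenAbove M r y rest v M<u@(M<y ∷ _) =
  (λ { (x , a) → let ((p , _) , x′) = proj₁ (acrossZero-run M r (y ∷ rest) v M≤u) x
                     (_ , g) = acrossZero-lookup (y ∷ rest) v x′ (here refl)
                 in p , proj₁ (proj₁ (free⇔free102×no100 v) a) , distinct-below p (proj₁ (noTripleFrom-bounded⇔ y v (v≤y p)) g) }) ,
  (λ { (p , a , dv) →
       proj₂ (acrossZero-run M r (y ∷ rest) v M≤u)
         ((p , proj₂ (noTripleFrom-bounded⇔ M v (All.map proj₂ p)) (distinct⇒uniqueOn v dv)) ,
          acrossZero-above M (y ∷ rest) v M<u p dv) ,
       proj₂ (free⇔free102×no100 v) (a , no100-distinct v dv) })
  where
  M≤u = All.map <⇒≤ M<u
  v≤y : All (Within M) v → All (_≤ y) v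
  v≤y p = All.map (λ q → ≤-trans (proj₂ q) (<⇒≤ M<y)) p
  distinct-below : All (Within M) v → UniqueOn (_< y) v → Distinct v
  distinct-below p = uniqueOn-mono v (All.map (λ q _ → ≤-<-trans (proj₂ q) M<y) p)

-- The later M, preceded by the larger y, forbids the letter M in v (a 100).
tailCondition-minReturns : ∀ m r y rest v → suc m < y → All (suc m ≤_) rest → suc m ∈ rest →
  (AcrossZero (replicate r (suc m) ++ y ∷ rest) v × Free v) ⇔ (All (Within m) v × Free102 v × Distinct v)
tailCondition-minReturns m r y rest v M<y M≤rest M∈rest =
  (λ { (x , a) → let x′ = dropRun r x
                     (p , _) = acrossZero-lookup rest v (proj₂ (proj₂ x′)) M∈rest
                     (_ , g) = acrossZero-lookup (y ∷ rest) v x′ (here refl)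
                 in All.zipWith (λ { ((0<z , z≤M) , ¬p) → 0<z , ≤-pred (≤∧≢⇒< z≤M (λ z≡M → ¬p (M<y , inj₁ z≡M))) })
                                (p , All.lookup (proj₁ x′) M∈rest) ,
                    proj₁ (proj₁ (free⇔free102×no100 v) a) ,
                    uniqueOn-mono v (All.map (λ q _ → ≤-<-trans (proj₂ q) M<y) p)
                      (proj₁ (noTripleFrom-bounded⇔ y v (All.map (λ q → ≤-trans (proj₂ q) (<⇒≤ M<y)) p)) g) }) ,
  (λ { (p , a , dv) → addRun r p dv , proj₂ (free⇔free102×no100 v) (a , no100-distinct v dv) })
  where
  M = suc m
  M≤u : All (M ≤_) (y ∷ rest)
  M≤u = <⇒≤ M<y ∷ M≤rest
  dropRun : ∀ r → AcrossZero (replicate r M ++ y ∷ rest) v → AcrossZero (y ∷ rest) v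
  dropRun zero    x = x
  dropRun (suc r) x = proj₂ (proj₁ (acrossZero-run M r (y ∷ rest) v M≤u) x)
  addRun : ∀ r → All (Within m) v → Distinct v → AcrossZero (replicate r M ++ y ∷ rest) v
  addRun zero    p dv = acrossZero-above m (y ∷ rest) v M≤u p dv
  addRun (suc r) p dv =
    proj₂ (acrossZero-run M r (y ∷ rest) v M≤u)
      ((p′ , proj₂ (noTripleFrom-bounded⇔ M v (All.map proj₂ p′)) (distinct⇒uniqueOn v dv)) , addRun zero p dv)
    where
    p′ : All (Within M) v
    p′ = All.map (λ { (0<z , z≤m) → 0<z , m≤n⇒m≤1+n z≤m }) p

stairs : ℕ → ℕ → List ℕ
stairs zero    K = []
stairs (suc n) K = K ∷ stairs n (suc K)

length-stairs : ∀ n K → length (stairs n K) ≡ n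
length-stairs zero    K = refl
length-stairs (suc n) K = cong suc (length-stairs n (suc K))

stairs-shift : ∀ n c K → stairs n (c + K) ≡ map (c +_) (stairs n K)
stairs-shift zero    c K = refl
stairs-shift (suc n) c K = cong (c + K ∷_) (trans (cong (stairs n) (sym (+-suc c K))) (stairs-shift n c (suc K)))

stairs-++ : ∀ a b K → stairs (a + b) K ≡ stairs a K ++ stairs b (a + K)
stairs-++ zero    b K = refl
stairs-++ (suc a) b K = cong (K ∷_) (trans (stairs-++ a b (suc K)) (cong (λ t → stairs a (suc K) ++ stairs b t) (+-suc a K)))

inBox-replicate-stairs : ∀ n M K → M < K → InBox (replicate n M) (stairs n K)
inBox-replicate-stairs zero    M K _   = []
inBox-replicate-stairs (suc n) M K M<K = M<K ∷ inBox-replicate-stairs n M (suc K) (m<n⇒m<1+n M<K)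

∑□-stairs-split : ∀ a b K (f : List ℕ → ℕ) → a ≤ b →
  ∑□ (stairs b K) f ≡ ∑□ (stairs a K) (λ u₁ → ∑□ (stairs (b ∸ a) (a + K)) (λ u₂ → f (u₁ ++ u₂)))
∑□-stairs-split a b K f a≤b =
  trans (cong (λ n → ∑□ (stairs n K) f) (sym (m+[n∸m]≡n a≤b)))
        (trans (cong (λ bs → ∑□ bs f) (stairs-++ a (b ∸ a) K)) (∑□-++ (stairs a K) (stairs (b ∸ a) (a + K)) f))

∑□-stairs-shift : ∀ n c k (f : List ℕ → ℕ) → c ≤ k → (∀ w → ¬ All (c ≤_) w → f w ≡ 0) →
  ∑□ (stairs n k) f ≡ ∑□ (stairs n (k ∸ c)) (λ w → f (map (c +_) w))
∑□-stairs-shift n c k f c≤k h =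
  trans (cong (λ t → ∑□ (stairs n t) f) (sym (m+[n∸m]≡n c≤k)))
        (trans (cong (λ bs → ∑□ bs f) (stairs-shift n c (k ∸ c))) (∑□-shift c (stairs n (k ∸ c)) f h))

-- The first recurrence

-- stairs n K = K, K+1, …, K+n−1 bounds the (K−1)-shifted inversion sequences, so α n K and
-- α′ n K are 𝔞_{n,K−1} and 𝔞′_{n,K−1}; β and γ are 𝔟 and 𝔠 (see 𝔞≡α, …, 𝔠≡γ).
α α′ β γ : ℕ → ℕ → ℕ
α  n K = ∑□ (stairs n K) (𝟙 ∘ free?)
α′ n K = ∑□ (stairs n K) (λ w → 𝟙 (free? w ×-dec primed? w))
β  n k = ∑□ (replicate n k) (λ w → 𝟙 (free102? w ×-dec distinct? w))
γ  n k = ∑□ (replicate n k) (λ w → 𝟙 (free102? w ×-dec uniqueOn? (λ x → ¬? (x ≟ k ∸ 1)) w))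

Positive : List ℕ → Set
Positive = All (1 ≤_)

positive? : ∀ w → Dec (Positive w)
positive? = All.all? (1 ≤?_)

positive-or-hasZero : ∀ w → Positive w ⊎ Any (_≡ 0) w
positive-or-hasZero []          = inj₁ []
positive-or-hasZero (zero  ∷ w) = inj₂ (here refl)
positive-or-hasZero (suc x ∷ w) = Sum.map (z<s ∷_) there (positive-or-hasZero w)

¬positive-hasZero : ∀ {w} → Positive w → ¬ Any (_≡ 0) w
¬positive-hasZero (1≤0 ∷ _)    (here refl) = 1+n≰n 1≤0
¬positive-hasZero (_ ∷ pos)    (there z∈w) = ¬positive-hasZero pos z∈w

positive-map-suc : ∀ w → Positive (map suc w)
positive-map-suc []      = []
positive-map-suc (x ∷ w) = z<s ∷ positive-map-suc w

α-positive : ∀ n K → ∑□ (stairs n (suc K)) (λ w → 𝟙 (free? w ×-dec positive? w)) ≡ α n K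
α-positive n K =
  trans (∑□-stairs-shift n 1 (suc K) f z<s (λ w ¬pos → 𝟙-no (free? w ×-dec positive? w) (¬pos ∘ proj₂)))
        (∑□-cong (stairs n K) (λ w _ → 𝟙-cong (free? (map suc w) ×-dec positive? (map suc w)) (free? w)
          (proj₁ (tripleFree-shift (pattern100∨102-shift 1) w) ∘ proj₁ ,
           (λ a → proj₂ (tripleFree-shift (pattern100∨102-shift 1) w) a , positive-map-suc w))))
  where
  f : List ℕ → ℕ
  f w = 𝟙 (free? w ×-dec positive? w)

-- A leading 0 is in no occurrence of 100 or 102; after a positive first letter the word is
-- either positive or has its first zero later.
α-by-first-letter : ∀ n K → α (suc n) (suc K) ≡
  α n (2 + K) + (∑□ (stairs (suc n) (suc K)) (λ w → 𝟙 (free? w ×-dec positive? w)) + α′ (suc n) (suc K))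
α-by-first-letter n K = begin
  ∑□ bs (λ w → 𝟙 (free? (0 ∷ w))) + ∑< K (λ x → ∑□ bs (λ w → 𝟙 (free? (suc x ∷ w))))
    ≡⟨ cong₂ _+_ (∑□-cong bs (λ w _ → 𝟙-cong (free? (0 ∷ w)) (free? w) (free-0∷ w)))
                 (∑<-cong K (λ x _ → trans (∑□-cong bs (λ w _ → split x w)) (∑□-distrib-+ bs (positiveTerm (suc x)) (primedTerm (suc x))))) ⟩
  α n (2 + K) + ∑< K (λ x → ∑□ bs (positiveTerm (suc x)) + ∑□ bs (primedTerm (suc x)))
    ≡⟨ cong (α n (2 + K) +_) (∑<-distrib-+ K _ _) ⟩
  α n (2 + K) + (∑< K (λ x → ∑□ bs (positiveTerm (suc x))) + ∑< K (λ x → ∑□ bs (primedTerm (suc x))))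
    ≡⟨ cong (α n (2 + K) +_) (sym (cong₂ _+_ (cong (_+ ∑< K (λ x → ∑□ bs (positiveTerm (suc x)))) (∑□-zero bs noPositive0))
                                                 (cong (_+ ∑< K (λ x → ∑□ bs (primedTerm (suc x)))) (∑□-zero bs noPrimed0)))) ⟩
  α n (2 + K) + (∑< (suc K) (λ x → ∑□ bs (positiveTerm x)) + ∑< (suc K) (λ x → ∑□ bs (primedTerm x))) ∎
  where
  open ≡-Reasoning
  bs = stairs n (2 + K)
  positiveTerm primedTerm : ℕ → List ℕ → ℕ
  positiveTerm x w = 𝟙 (free? (x ∷ w) ×-dec positive? (x ∷ w))
  primedTerm x w = 𝟙 (free? (x ∷ w) ×-dec primed? (x ∷ w))
  noPositive0 : ∀ w → InBox w bs → positiveTerm 0 w ≡ 0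
  noPositive0 w _ = 𝟙-no (free? (0 ∷ w) ×-dec positive? (0 ∷ w)) (λ { (_ , () ∷ _) })
  noPrimed0 : ∀ w → InBox w bs → primedTerm 0 w ≡ 0
  noPrimed0 w _ = 𝟙-no (free? (0 ∷ w) ×-dec primed? (0 ∷ w)) (λ { (_ , 0≢0 , _) → 0≢0 refl })
  split : ∀ x w → 𝟙 (free? (suc x ∷ w)) ≡ positiveTerm (suc x) w + primedTerm (suc x) w
  split x w = 𝟙-⊎ (free? (suc x ∷ w)) (free? (suc x ∷ w) ×-dec positive? (suc x ∷ w)) (free? (suc x ∷ w) ×-dec primed? (suc x ∷ w))
    ((λ a → Sum.map (λ pos → a , z<s ∷ pos) (λ z∈w → a , (λ ()) , z∈w) (positive-or-hasZero w)) ,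
     [ proj₁ , proj₁ ]′)
    (λ { ((_ , _ ∷ pos) , (_ , _ , z∈w)) → ¬positive-hasZero pos z∈w })

α-recurrence : ∀ n K → α (suc n) (suc K) ≡ α (suc n) K + α n (2 + K) + α′ (suc n) (suc K)
α-recurrence n K = begin
  α (suc n) (suc K)                               ≡⟨ α-by-first-letter n K ⟩
  α n (2 + K) + (P + α′ (suc n) (suc K))          ≡⟨ cong (λ t → α n (2 + K) + (t + α′ (suc n) (suc K))) (α-positive (suc n) K) ⟩
  α n (2 + K) + (α (suc n) K + α′ (suc n) (suc K)) ≡⟨ sym (+-assoc (α n (2 + K)) _ _) ⟩
  α n (2 + K) + α (suc n) K + α′ (suc n) (suc K)   ≡⟨ cong (_+ α′ (suc n) (suc K)) (+-comm (α n (2 + K)) _) ⟩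
  α (suc n) K + α n (2 + K) + α′ (suc n) (suc K)   ∎
  where
  open ≡-Reasoning
  P = ∑□ (stairs (suc n) (suc K)) (λ w → 𝟙 (free? w ×-dec positive? w))

-- Splitting at the first zero

hasZero? : ∀ w → Dec (Any (_≡ 0) w)
hasZero? = Any.any? (_≟ 0)

∑□-positive-by-first-letter : ∀ q K (h : List ℕ → ℕ) →
  ∑□ (stairs (suc q) (suc K)) (λ u → 𝟙 (positive? u) * h u)
  ≡ ∑< K (λ x → ∑□ (stairs q (2 + K)) (λ u → 𝟙 (positive? u) * h (suc x ∷ u)))
∑□-positive-by-first-letter q K h =
  cong₂ _+_ (∑□-zero (stairs q (2 + K)) (λ u _ → cong (_* h (0 ∷ u)) (𝟙-no (positive? (0 ∷ u)) (λ { (() ∷ _) }))))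
            (∑<-cong K (λ x _ → ∑□-cong (stairs q (2 + K)) (λ u _ →
              cong (_* h (suc x ∷ u)) (𝟙-cong (positive? (suc x ∷ u)) (positive? u) ((λ { (_ ∷ pos) → pos }) , (z<s ∷_))))))

-- q is the position of the first zero, u the positive prefix before it and v the tail after it.
∑□-by-first-zero : ∀ n K (g : List ℕ → ℕ) → ∑□ (stairs n (suc K)) (λ w → 𝟙 (hasZero? w) * g w) ≡
  ∑< n (λ q → ∑□ (stairs q (suc K)) (λ u → 𝟙 (positive? u) * ∑□ (stairs (n ∸ suc q) (suc K + suc q)) (λ v → g (u ++ 0 ∷ v))))
∑□-by-first-zero zero    K g = refl
∑□-by-first-zero (suc n) K g = begin
  ∑□ bs (λ w → 𝟙 (hasZero? (0 ∷ w)) * g (0 ∷ w)) + ∑< K (λ x → ∑□ bs (λ w → 𝟙 (hasZero? (suc x ∷ w)) * g (suc x ∷ w)))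
    ≡⟨ cong₂ _+_ (∑□-cong bs (λ w _ → trans (cong (_* g (0 ∷ w)) (𝟙-yes (hasZero? (0 ∷ w)) (here refl))) (*-identityˡ _)))
                 (∑<-cong K (λ x _ → trans (∑□-cong bs (λ w _ → cong (_* g (suc x ∷ w)) (𝟙-cong (hasZero? (suc x ∷ w)) (hasZero? w)
                                                                   ((λ { (here ()) ; (there z∈w) → z∈w }) , there))))
                                           (∑□-by-first-zero n (suc K) (λ w → g (suc x ∷ w))))) ⟩
  ∑□ bs (λ w → g (0 ∷ w)) + ∑< K (λ x → ∑< n (λ q → afterFirst q x))
    ≡⟨ cong₂ _+_ (trans (cong (λ t → ∑□ (stairs n t) (λ w → g (0 ∷ w))) (+-comm 1 (suc K))) (sym (*-identityˡ _)))
                 (trans (∑<-comm K n _) (∑<-cong n (λ q _ → sym (prefix q)))) ⟩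
  1 * ∑□ (stairs n (suc K + 1)) (λ v → g (0 ∷ v))
    + ∑< n (λ q → ∑□ (stairs (suc q) (suc K)) (λ u → 𝟙 (positive? u) *
                    ∑□ (stairs (n ∸ suc q) (suc K + suc (suc q))) (λ v → g (u ++ 0 ∷ v)))) ∎
  where
  open ≡-Reasoning
  bs = stairs n (2 + K)
  afterFirst : ℕ → ℕ → ℕ
  afterFirst q x = ∑□ (stairs q (2 + K)) (λ u → 𝟙 (positive? u) *
                     ∑□ (stairs (n ∸ suc q) (2 + K + suc q)) (λ v → g (suc x ∷ u ++ 0 ∷ v)))
  prefix : ∀ q → ∑□ (stairs (suc q) (suc K)) (λ u →
                   𝟙 (positive? u) * ∑□ (stairs (n ∸ suc q) (suc K + suc (suc q))) (λ v → g (u ++ 0 ∷ v)))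
                 ≡ ∑< K (afterFirst q)
  prefix q =
    trans (∑□-cong (stairs (suc q) (suc K)) (λ u _ →
             cong (λ t → 𝟙 (positive? u) * ∑□ (stairs (n ∸ suc q) t) (λ v → g (u ++ 0 ∷ v))) (+-suc (suc K) (suc q))))
          (∑□-positive-by-first-letter q K (λ u → ∑□ (stairs (n ∸ suc q) (2 + K + suc q)) (λ v → g (u ++ 0 ∷ v))))

-- For σ ∈ 𝒜′ the first zero is at position ≥ 1 and the prefix before it is nonempty.
α′-by-first-zero : ∀ n K → α′ (suc n) (suc K) ≡ ∑< n (λ q → ∑□ (stairs (suc q) (suc K)) (λ u → 𝟙 (positive? u) *
  ∑□ (stairs (n ∸ suc q) (2 + K + suc q)) (λ v → 𝟙 (free? (u ++ 0 ∷ v)))))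
α′-by-first-zero n K = begin
  α′ (suc n) (suc K)
    ≡⟨ cong (_+ ∑< K (λ x → ∑□ bs (λ w → 𝟙 (free? (suc x ∷ w) ×-dec primed? (suc x ∷ w)))))
            (∑□-zero bs (λ w _ → 𝟙-no (free? (0 ∷ w) ×-dec primed? (0 ∷ w)) (λ { (_ , 0≢0 , _) → 0≢0 refl }))) ⟩
  ∑< K (λ x → ∑□ bs (λ w → 𝟙 (free? (suc x ∷ w) ×-dec primed? (suc x ∷ w))))
    ≡⟨ ∑<-cong K (λ x _ → trans (∑□-cong bs (λ w _ → 𝟙-× (free? (suc x ∷ w) ×-dec primed? (suc x ∷ w)) (hasZero? w) (free? (suc x ∷ w))
                                                     ((λ { (a , _ , z∈w) → z∈w , a }) , (λ { (z∈w , a) → a , (λ ()) , z∈w }))))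
                                (∑□-by-first-zero n (suc K) (λ w → 𝟙 (free? (suc x ∷ w))))) ⟩
  ∑< K (λ x → ∑< n (λ q → ∑□ (stairs q (2 + K)) (λ u → 𝟙 (positive? u) * tails q (suc x ∷ u))))
    ≡⟨ ∑<-comm K n _ ⟩
  ∑< n (λ q → ∑< K (λ x → ∑□ (stairs q (2 + K)) (λ u → 𝟙 (positive? u) * tails q (suc x ∷ u))))
    ≡⟨ ∑<-cong n (λ q _ → sym (∑□-positive-by-first-letter q K (tails q))) ⟩
  ∑< n (λ q → ∑□ (stairs (suc q) (suc K)) (λ u → 𝟙 (positive? u) * tails q u)) ∎
  where
  open ≡-Reasoning
  bs = stairs n (2 + K)
  tails : ℕ → List ℕ → ℕ
  tails q u = ∑□ (stairs (n ∸ suc q) (2 + K + suc q)) (λ v → 𝟙 (free? (u ++ 0 ∷ v)))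

within? : ∀ c z → Dec (Within c z)
within? c z = (0 <? z) ×-dec (z ≤? c)

replicate≤stairs : ∀ L d E → d ≤ E → Pointwise _≤_ (replicate L d) (stairs L E)
replicate≤stairs zero    d E _   = []
replicate≤stairs (suc L) d E d≤E = d≤E ∷ replicate≤stairs L d (suc E) (m≤n⇒m≤1+n d≤E)

inBox-replicate : ∀ L E d w → InBox w (stairs L E) → All (_< d) w → InBox w (replicate L d)
inBox-replicate zero    E d []      _          _          = []
inBox-replicate (suc L) E d (x ∷ w) (_ ∷ w∈)   (x<d ∷ w<d) = x<d ∷ inBox-replicate L (suc E) d w w∈ w<d

inBox-replicate⇒All : ∀ L d w → InBox w (replicate L d) → All (_< d) w
inBox-replicate⇒All zero    d []      _           = []
inBox-replicate⇒All (suc L) d (x ∷ w) (x<d ∷ w∈) = x<d ∷ inBox-replicate⇒All L d w w∈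

-- Tails with letters in [1, c] are words over [0, c) after subtracting 1.
∑□-within : ∀ L E c {Q : ℕ → Set} (Q? : ∀ x → Dec (Q x)) → c < E →
  ∑□ (stairs L E) (λ v → 𝟙 (All.all? (within? c) v ×-dec free102? v ×-dec uniqueOn? Q? v))
  ≡ ∑□ (replicate L c) (λ w → 𝟙 (free102? w ×-dec uniqueOn? (Q? ∘ suc) w))
∑□-within L E c {Q} Q? c<E = begin
  ∑□ (stairs L E) f
    ≡⟨ ∑□-restrict (replicate L (suc c)) (stairs L E) f (replicate≤stairs L (suc c) E c<E)
         (λ w w∈ w∉ → 𝟙-no (dec w) (λ { (p , _) → w∉ (inBox-replicate L E (suc c) w w∈ (All.map (s≤s ∘ proj₂) p)) })) ⟩
  ∑□ (replicate L (suc c)) f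
    ≡⟨ cong (λ bs → ∑□ bs f) (sym (map-replicate (1 +_) L c)) ⟩
  ∑□ (map (1 +_) (replicate L c)) f
    ≡⟨ ∑□-shift 1 (replicate L c) f (λ w ¬pos → 𝟙-no (dec w) (λ { (p , _) → ¬pos (All.map proj₁ p) })) ⟩
  ∑□ (replicate L c) (λ w → f (map suc w))
    ≡⟨ ∑□-cong (replicate L c) (λ w w∈ → 𝟙-cong (dec (map suc w)) (free102? w ×-dec uniqueOn? (Q? ∘ suc) w) (shift w w∈)) ⟩
  ∑□ (replicate L c) (λ w → 𝟙 (free102? w ×-dec uniqueOn? (Q? ∘ suc) w)) ∎
  where
  open ≡-Reasoning
  dec : ∀ v → Dec (All (Within c) v × Free102 v × UniqueOn Q v)
  dec v = All.all? (within? c) v ×-dec free102? v ×-dec uniqueOn? Q? v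
  f : List ℕ → ℕ
  f = 𝟙 ∘ dec
  shift : ∀ w → InBox w (replicate L c) →
    (All (Within c) (map suc w) × Free102 (map suc w) × UniqueOn Q (map suc w)) ⇔ (Free102 w × UniqueOn (Q ∘ suc) w)
  shift w w∈ =
    (λ { (_ , a , n) → proj₁ (tripleFree-shift (pattern102-shift 1) w) a , proj₁ (uniqueOn-shift 1 w) n }) ,
    (λ { (a , n) → All.map⁺ (All.map (λ z<c → z<s , z<c) (inBox-replicate⇒All L c w w∈)) ,
                   proj₂ (tripleFree-shift (pattern102-shift 1) w) a , proj₂ (uniqueOn-shift 1 w) n })

∑□-within-distinct : ∀ L E c → c < E →
  ∑□ (stairs L E) (λ v → 𝟙 (All.all? (within? c) v ×-dec free102? v ×-dec distinct? v)) ≡ β L c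
∑□-within-distinct L E c = ∑□-within L E c (λ _ → yes tt)

∑□-within-uniqueBelow : ∀ L E m → suc m < E →
  ∑□ (stairs L E) (λ v → 𝟙 (All.all? (within? (suc m)) v ×-dec free102? v ×-dec uniqueOn? (_<? suc m) v)) ≡ γ L (suc m)
∑□-within-uniqueBelow L E m M<E =
  trans (∑□-within L E (suc m) (_<? suc m) M<E)
    (∑□-cong (replicate L (suc m)) (λ w w∈ →
      𝟙-cong (free102? w ×-dec uniqueOn? (λ x → suc x <? suc m) w) (free102? w ×-dec uniqueOn? (λ x → ¬? (x ≟ m)) w)
        (let w≤m = All.map ≤-pred (inBox-replicate⇒All L (suc m) w w∈) in
         (λ { (a , n) → a , uniqueOn-mono w (All.map (λ z≤m z≢m → s<s (≤∧≢⇒< z≤m z≢m)) w≤m) n }) ,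
         (λ { (a , n) → a , uniqueOn-mono w (All.universal (λ z z<m → <⇒≢ (s<s⁻¹ z<m)) w) n }))))

-- The prefix before the first zero

AllAbove : ℕ → List ℕ → Set
AllAbove M []      = ⊥
AllAbove M (y ∷ w) = All (M <_) (y ∷ w)

allAbove? : ∀ M w → Dec (AllAbove M w)
allAbove? M []      = no (λ ())
allAbove? M (y ∷ w) = All.all? (M <?_) (y ∷ w)

allAbove⇒> : ∀ {M w} → AllAbove M w → All (M <_) w
allAbove⇒> {w = _ ∷ _} M<w = M<w

AboveThenMin : ℕ → List ℕ → Set
AboveThenMin M []      = ⊥
AboveThenMin M (y ∷ w) = M < y × All (M ≤_) w × M ∈ w

aboveThenMin? : ∀ M w → Dec (AboveThenMin M w)
aboveThenMin? M []      = no (λ ())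
aboveThenMin? M (y ∷ w) = (M <? y) ×-dec All.all? (M ≤?_) w ×-dec Any.any? (M ≟_) w

aboveThenMin⇒≥ : ∀ {M w} → AboveThenMin M w → All (M ≤_) w
aboveThenMin⇒≥ {w = _ ∷ _} (M<y , M≤w , _) = <⇒≤ M<y ∷ M≤w

∑□-allAbove : ∀ n k M → 0 < n → suc M ≤ k →
  ∑□ (stairs n k) (λ w → 𝟙 (allAbove? M w ×-dec free? w)) ≡ α n (k ∸ suc M)
∑□-allAbove n k M 0<n M<k =
  trans (∑□-stairs-shift n (suc M) k f M<k (λ w ¬w> → 𝟙-no (allAbove? M w ×-dec free? w) (¬w> ∘ allAbove⇒> ∘ proj₁)))
        (∑□-cong (stairs n (k ∸ suc M)) (λ w w∈ → 𝟙-cong (allAbove? M (map (suc M +_) w) ×-dec free? (map (suc M +_) w)) (free? w)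
          (proj₁ (tripleFree-shift (pattern100∨102-shift (suc M)) w) ∘ proj₂ ,
           (λ a → above w w∈ , proj₂ (tripleFree-shift (pattern100∨102-shift (suc M)) w) a))))
  where
  f : List ℕ → ℕ
  f w = 𝟙 (allAbove? M w ×-dec free? w)
  above : ∀ w → InBox w (stairs n (k ∸ suc M)) → AllAbove M (map (suc M +_) w)
  above []      w∈ = ⊥-elim (<⇒≢ 0<n (sym (trans (sym (length-stairs n _)) (sym (Pointwise-length w∈)))))
  above (y ∷ w) _  = All.map⁺ (All.universal (λ z → s≤s (m≤m+n M z)) (y ∷ w))

aboveThenMin-shift⇔ : ∀ M w → AboveThenMin M (map (M +_) w) ⇔ Primed w
aboveThenMin-shift⇔ M []      = (λ ()) , (λ ())
aboveThenMin-shift⇔ M (y ∷ w) =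
  (λ { (M<M+y , _ , M∈) → (λ y≡0 → <-irrefl (sym (trans (cong (M +_) y≡0) (+-identityʳ M))) M<M+y) , zero∈ w M∈ }) ,
  (λ { (y≢0 , 0∈w) → M<M+ y≢0 , All.map⁺ (All.universal (m≤m+n M) w) , ∈-shifted w 0∈w })
  where
  M<M+ : ∀ {y} → y ≢ 0 → M < M + y
  M<M+ {zero}  y≢0 = ⊥-elim (y≢0 refl)
  M<M+ {suc y} _   = m<m+n M z<s
  zero∈ : ∀ w → M ∈ map (M +_) w → Any (_≡ 0) w
  zero∈ (z ∷ w) (here M≡M+z) = here (+-cancelˡ-≡ M z 0 (trans (sym M≡M+z) (sym (+-identityʳ M))))
  zero∈ (z ∷ w) (there M∈)   = there (zero∈ w M∈)
  ∈-shifted : ∀ w → Any (_≡ 0) w → M ∈ map (M +_) w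
  ∈-shifted (z ∷ w) (here z≡0) = here (trans (sym (+-identityʳ M)) (cong (M +_) (sym z≡0)))
  ∈-shifted (z ∷ w) (there 0∈) = there (∈-shifted w 0∈)

∑□-aboveThenMin : ∀ n k M → M ≤ k →
  ∑□ (stairs n k) (λ w → 𝟙 (aboveThenMin? M w ×-dec free? w)) ≡ α′ n (k ∸ M)
∑□-aboveThenMin n k M M≤k =
  trans (∑□-stairs-shift n M k f M≤k (λ w ¬w≥ → 𝟙-no (aboveThenMin? M w ×-dec free? w) (¬w≥ ∘ aboveThenMin⇒≥ ∘ proj₁)))
        (∑□-cong (stairs n (k ∸ M)) (λ w _ → 𝟙-cong (aboveThenMin? M (map (M +_) w) ×-dec free? (map (M +_) w)) (free? w ×-dec primed? w)
          ((λ { (p , a) → proj₁ (tripleFree-shift (pattern100∨102-shift M) w) a , proj₁ (aboveThenMin-shift⇔ M w) p }) ,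
           (λ { (a , p) → proj₂ (aboveThenMin-shift⇔ M w) p , proj₂ (tripleFree-shift (pattern100∨102-shift M) w) a }))))
  where
  f : List ℕ → ℕ
  f w = 𝟙 (aboveThenMin? M w ×-dec free? w)

RunThen : ℕ → ℕ → (List ℕ → Set) → List ℕ → Set
RunThen M r Rest u = take r u ≡ replicate r M × Rest (drop r u)

runThen? : ∀ M r {Rest : List ℕ → Set} → (∀ w → Dec (Rest w)) → ∀ u → Dec (RunThen M r Rest u)
runThen? M r Rest? u = ≡-dec _≟_ (take r u) (replicate r M) ×-dec Rest? (drop r u)

take-drop-++ : ∀ {n} (xs ys : List ℕ) → length xs ≡ n → take n (xs ++ ys) ≡ xs × drop n (xs ++ ys) ≡ ys
take-drop-++ []       ys refl = refl , refl
take-drop-++ (x ∷ xs) ys refl = let (t , d) = take-drop-++ xs ys refl in cong (x ∷_) t , d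

runThen-++ : ∀ M r {Rest : List ℕ → Set} rest → Rest rest → RunThen M r Rest (replicate r M ++ rest)
runThen-++ M r {Rest} rest p =
  let (t , d) = take-drop-++ (replicate r M) rest (length-replicate r) in t , subst Rest (sym d) p

run-split : ∀ {M : ℕ} r (u : List ℕ) → take r u ≡ replicate r M → u ≡ replicate r M ++ drop r u
run-split r u t = trans (sym (take++drop≡id r u)) (cong (_++ drop r u) t)

HeadNot : ℕ → List ℕ → Set
HeadNot M []      = ⊤
HeadNot M (y ∷ _) = y ≢ M

run-unique : ∀ M r r′ rest rest′ → replicate r M ++ rest ≡ replicate r′ M ++ rest′ →
  HeadNot M rest → HeadNot M rest′ → r ≡ r′ × rest ≡ rest′
run-unique M zero    zero     rest       rest′       e _  _  = refl , e
run-unique M zero    (suc r′) (y ∷ rest) rest′       e y≢M _  = ⊥-elim (y≢M (∷-injectiveˡ e))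
run-unique M (suc r) zero     rest       (y ∷ rest′) e _  y≢M = ⊥-elim (y≢M (sym (∷-injectiveˡ e)))
run-unique M (suc r) (suc r′) rest       rest′       e h  h′ =
  let (r≡r′ , rest≡rest′) = run-unique M r r′ rest rest′ (∷-injectiveʳ e) h h′ in cong suc r≡r′ , rest≡rest′

minimum : ∀ x w → Σ ℕ λ m → m ∈ x ∷ w × All (m ≤_) (x ∷ w)
minimum x []      = x , here refl , ≤-refl ∷ []
minimum x (y ∷ w) with minimum y w
... | m , m∈ , m≤ with x ≤? m
...   | yes x≤m = x , here refl , ≤-refl ∷ All.map (≤-trans x≤m) m≤
...   | no  x≰m = m , there m∈ , <⇒≤ (≰⇒> x≰m) ∷ m≤

leadingRun : ∀ M u → Σ ℕ λ r → Σ (List ℕ) λ rest → u ≡ replicate r M ++ rest × HeadNot M rest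
leadingRun M []      = 0 , [] , refl , tt
leadingRun M (x ∷ w) with x ≟ M
... | yes refl = let (r , rest , e , h) = leadingRun M w in suc r , rest , cong (x ∷_) e , h
... | no  x≢M  = 0 , x ∷ w , refl , x≢M

-- The shapes of a prefix u of length q + 1 with minimum M: u = M^(q+1) (the 𝔠 term),
-- M^(r+1) followed by letters above M (the 𝔞·𝔟 terms) or M^r, a letter above M and a
-- later M (the 𝔞′·𝔟 terms).
data Shape : Set where
  allMin                  : Shape
  minThenAbove minReturns : ℕ → Shape

module ShapeOf (q : ℕ) where

  runLength : Shape → ℕ
  runLength allMin           = suc q
  runLength (minThenAbove r) = suc r
  runLength (minReturns r)   = r

  Rest : ℕ → Shape → List ℕ → Set
  Rest M allMin           = _≡ []
  Rest M (minThenAbove _) = AllAbove M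
  Rest M (minReturns _)   = AboveThenMin M

  rest? : ∀ M c w → Dec (Rest M c w)
  rest? M allMin           []      = yes refl
  rest? M allMin           (_ ∷ _) = no (λ ())
  rest? M (minThenAbove _) = allAbove? M
  rest? M (minReturns _)   = aboveThenMin? M

  HasShape : ℕ → Shape → List ℕ → Set
  HasShape M c = RunThen M (runLength c) (Rest M c)

  hasShape? : ∀ M c u → Dec (HasShape M c u)
  hasShape? M c = runThen? M (runLength c) (rest? M c)

  ShapeInRange : Shape → Set
  ShapeInRange allMin           = ⊤
  ShapeInRange (minThenAbove r) = r < q
  ShapeInRange (minReturns r)   = r ≤ q

  rest-headNot : ∀ {M} c {w} → Rest M c w → HeadNot M w
  rest-headNot allMin           refl               = tt
  rest-headNot (minThenAbove _) {y ∷ w} (M<y ∷ _)  = λ y≡M → <-irrefl (sym y≡M) M<y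
  rest-headNot (minReturns _)   {y ∷ w} (M<y , _)  = λ y≡M → <-irrefl (sym y≡M) M<y

  rest-≥ : ∀ {M} c {w} → Rest M c w → All (M ≤_) w
  rest-≥ allMin           refl = []
  rest-≥ (minThenAbove _) p    = All.map <⇒≤ (allAbove⇒> p)
  rest-≥ (minReturns _)   p    = aboveThenMin⇒≥ p

  shape-≥ : ∀ {M} c {u} → HasShape M c u → All (M ≤_) u
  shape-≥ {M} c {u} (t , p) =
    subst (All (M ≤_)) (sym (run-split (runLength c) u t)) (replicate-++-≥ M (runLength c) _ (rest-≥ c p))

  shape-∈ : ∀ {M} c {u} → HasShape M c u → M ∈ u
  shape-∈ {M} c {u} (t , p) = subst (M ∈_) (sym (run-split (runLength c) u t)) (go c p)
    where
    go : ∀ c {w} → Rest M c w → M ∈ replicate (runLength c) M ++ w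
    go allMin           _ = here refl
    go (minThenAbove _) _ = here refl
    go (minReturns r) {y ∷ w} (_ , _ , M∈w) = ++⁺ʳ (replicate r M) (there M∈w)

  shape-unique : ∀ {M M′} c c′ {u} → HasShape M c u → HasShape M′ c′ u → M ≡ M′ × c ≡ c′
  shape-unique {M} {M′} c c′ {u} h h′
    with ≤-antisym (All.lookup (shape-≥ c h) (shape-∈ c′ h′)) (All.lookup (shape-≥ c′ h′) (shape-∈ c h))
  ... | refl =
    let (r≡ , rest≡) = run-unique M _ _ _ _ (trans (sym (run-split _ u (proj₁ h))) (run-split _ u (proj₁ h′)))
                                  (rest-headNot c (proj₂ h)) (rest-headNot c′ (proj₂ h′))
    in refl , same-shape c c′ r≡ (proj₂ h) (subst (Rest M c′) (sym rest≡) (proj₂ h′))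
    where
    same-shape : ∀ c c′ {w} → runLength c ≡ runLength c′ → Rest M c w → Rest M c′ w → c ≡ c′
    same-shape allMin           allMin           _  _ _ = refl
    same-shape (minThenAbove a) (minThenAbove b) r≡ _ _ = cong minThenAbove (suc-injective r≡)
    same-shape (minReturns a)   (minReturns b)   r≡ _ _ = cong minReturns r≡
    same-shape allMin           (minThenAbove _) _ refl ()
    same-shape allMin           (minReturns _)   _ refl ()
    same-shape (minThenAbove _) allMin           _ () refl
    same-shape (minReturns _)   allMin           _ () refl
    same-shape (minThenAbove _) (minReturns _) {y ∷ w} _ M<w (_ , _ , M∈w) = ⊥-elim (<-irrefl refl (All.lookup M<w (there M∈w)))
    same-shape (minReturns _) (minThenAbove _) {y ∷ w} _ (_ , _ , M∈w) M<w = ⊥-elim (<-irrefl refl (All.lookup M<w (there M∈w)))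

  shape-of-run : ∀ M r rest → HeadNot M rest → All (M ≤_) rest → M ∈ replicate r M ++ rest → r + length rest ≡ suc q →
    Σ Shape λ c → ShapeInRange c × HasShape M c (replicate r M ++ rest)
  shape-of-run M r []      _   _   _   r+0≡ =
    allMin , tt , subst (λ k → HasShape M allMin (replicate k M ++ [])) (sym (trans (sym (+-identityʳ r)) r+0≡))
                        (runThen-++ M (suc q) {Rest M allMin} [] refl)
  shape-of-run M r (y ∷ w) y≢M M≤y∷w M∈u len with Any.any? (M ≟_) w | M≤y∷w
  ... | yes M∈w | M≤y ∷ M≤w =
    minReturns r , r≤q , runThen-++ M r {Rest M (minReturns r)} (y ∷ w) (≤∧≢⇒< M≤y (y≢M ∘ sym) , M≤w , M∈w)
    where
    r≤q : r ≤ q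
    r≤q = ≤-pred (subst (r <_) len (m<m+n r z<s))
  ... | no M∉w | M≤y ∷ M≤w with r
  ...   | zero   = ⊥-elim (M∉y∷w M∈u)
    where
    M∉y∷w : M ∉ y ∷ w
    M∉y∷w (here M≡y)  = y≢M (sym M≡y)
    M∉y∷w (there M∈w) = M∉w M∈w
  ...   | suc r′ =
    minThenAbove r′ , r′<q , runThen-++ M (suc r′) {Rest M (minThenAbove r′)} (y ∷ w) (≤∧≢⇒< M≤y (y≢M ∘ sym) ∷ above w M≤w M∉w)
    where
    r′<q : r′ < q
    r′<q = ≤-pred (subst (suc r′ <_) len (m<m+n (suc r′) z<s))
    above : ∀ w → All (M ≤_) w → M ∉ w → All (M <_) w
    above []      _          _   = []
    above (z ∷ w) (M≤z ∷ M≤w) M∉ = ≤∧≢⇒< M≤z (M∉ ∘ here) ∷ above w M≤w (M∉ ∘ there)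

  shape-exists : ∀ s u → InBox u (stairs (suc q) (suc s)) → Positive u →
    Σ ℕ λ m → m < s × Σ Shape λ c → ShapeInRange c × HasShape (suc m) c u
  shape-exists s (x ∷ w) u∈@(x<K ∷ _) pos with minimum x w
  ... | M , M∈u , M≤u with All.lookup pos M∈u | All.lookup M≤u (here refl)
  ... | 1≤M | M≤x with M | leadingRun M (x ∷ w)
  ...   | suc m | r , rest , u≡ , hd =
    m , ≤-pred (≤-<-trans M≤x x<K) ,
    let (c , c-in-range , h) = shape-of-run (suc m) r rest hd (All.++⁻ʳ (replicate r (suc m)) (subst (All (suc m ≤_)) u≡ M≤u))
                    (subst (suc m ∈_) u≡ M∈u) len
    in c , c-in-range , subst (HasShape (suc m) c) (sym u≡) h
    where
    len : r + length rest ≡ suc q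
    len = trans (sym (trans (length-++ (replicate r (suc m))) (cong (_+ length rest) (length-replicate r))))
                (trans (cong length (sym u≡)) (trans (Pointwise-length u∈) (length-stairs (suc q) (suc s))))

  shapeIndicators : ℕ → List ℕ → ℕ → ℕ
  shapeIndicators M u X =
    𝟙 (hasShape? M allMin u) * X + ∑< q (λ r → 𝟙 (hasShape? M (minThenAbove r) u) * X)
                                 + ∑< (suc q) (λ r → 𝟙 (hasShape? M (minReturns r) u) * X)

  shapeIndicators-none : ∀ M u X → (∀ c → ¬ HasShape M c u) → shapeIndicators M u X ≡ 0
  shapeIndicators-none M u X none =
    cong₂ _+_ (cong₂ _+_ (vanish allMin) (∑<-zero q (λ r _ → vanish (minThenAbove r))))
              (∑<-zero (suc q) (λ r _ → vanish (minReturns r)))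
    where
    vanish : ∀ c → 𝟙 (hasShape? M c u) * X ≡ 0
    vanish c = cong (_* X) (𝟙-no (hasShape? M c u) (none c))

  shapeIndicator-other : ∀ {M u} X c → HasShape M c u → ∀ c′ → c′ ≢ c → 𝟙 (hasShape? M c′ u) * X ≡ 0
  shapeIndicator-other X c h c′ c′≢c = cong (_* X) (𝟙-no (hasShape? _ c′ _) (λ h′ → c′≢c (proj₂ (shape-unique c′ c h′ h))))

  shapeIndicator-own : ∀ {M u} X c → HasShape M c u → 𝟙 (hasShape? M c u) * X ≡ X
  shapeIndicator-own X c h = trans (cong (_* X) (𝟙-yes (hasShape? _ c _) h)) (*-identityˡ X)

  shapeIndicators-unique : ∀ M u X c → ShapeInRange c → HasShape M c u → shapeIndicators M u X ≡ X
  shapeIndicators-unique M u X allMin _ h =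
    trans (cong₂ _+_ (cong₂ _+_ (shapeIndicator-own X allMin h) (∑<-zero q (λ r _ → other (minThenAbove r) (λ ()))))
                     (∑<-zero (suc q) (λ r _ → other (minReturns r) (λ ()))))
          (trans (+-identityʳ _) (+-identityʳ X))
    where other = shapeIndicator-other X allMin h
  shapeIndicators-unique M u X (minThenAbove r₀) r₀<q h =
    trans (cong₂ _+_ (cong₂ _+_ (other allMin (λ ()))
                                (∑<-single q r₀ r₀<q (λ r _ r≢r₀ → other (minThenAbove r) (λ { refl → r≢r₀ refl }))))
                     (∑<-zero (suc q) (λ r _ → other (minReturns r) (λ ()))))
          (trans (+-identityʳ _) (shapeIndicator-own X (minThenAbove r₀) h))
    where other = shapeIndicator-other X (minThenAbove r₀) h
  shapeIndicators-unique M u X (minReturns r₀) r₀≤q h =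
    trans (cong₂ _+_ (cong₂ _+_ (other allMin (λ ())) (∑<-zero q (λ r _ → other (minThenAbove r) (λ ()))))
                     (∑<-single (suc q) r₀ (s≤s r₀≤q) (λ r _ r≢r₀ → other (minReturns r) (λ { refl → r≢r₀ refl }))))
          (shapeIndicator-own X (minReturns r₀) h)
    where other = shapeIndicator-other X (minReturns r₀) h

  𝟙-positive-by-shape : ∀ s u X → InBox u (stairs (suc q) (suc s)) →
    𝟙 (positive? u) * X ≡ ∑< s (λ m → shapeIndicators (suc m) u X)
  𝟙-positive-by-shape s u X u∈ with positive? u
  ... | no ¬pos = sym (∑<-zero s (λ m _ → shapeIndicators-none (suc m) u X
                                    (λ c h → ¬pos (All.map (≤-trans (s≤s z≤n)) (shape-≥ c h)))))
  ... | yes pos with shape-exists s u u∈ pos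
  ...   | m₀ , m₀<s , c₀ , c₀-in-range , h₀ =
    trans (*-identityˡ X) (sym (trans
      (∑<-single s m₀ m₀<s (λ m _ m≢m₀ → shapeIndicators-none (suc m) u X
                                            (λ c h → m≢m₀ (suc-injective (proj₁ (shape-unique c c₀ h h₀))))))
      (shapeIndicators-unique (suc m₀) u X c₀ c₀-in-range h₀)))

-- Words u 0 v of 𝒜′ with u ∈ stairs (q + 1) (s + 1) and v ∈ stairs L E.
module PrefixCounts (s q L E : ℕ) (s<E : s < E) where
  open ShapeOf q

  K : ℕ
  K = suc s

  tails : List ℕ → ℕ
  tails u = ∑□ (stairs L E) (λ v → 𝟙 (free? (u ++ 0 ∷ v)))

  tails-factor : ∀ u {P : List ℕ → Set} (P? : ∀ v → Dec (P v)) → All (0 <_) u →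
    (∀ v → (AcrossZero u v × Free v) ⇔ P v) → tails u ≡ 𝟙 (free? u) * ∑□ (stairs L E) (𝟙 ∘ P?)
  tails-factor u P? pos h =
    trans (∑□-cong (stairs L E) (λ v _ → 𝟙-× (free? (u ++ 0 ∷ v)) (free? u) (P? v)
             ((λ f → let (a , x , b) = proj₁ (free-split-at-zero u v pos) f in a , proj₁ (h v) (x , b)) ,
              (λ { (a , p) → let (x , b) = proj₂ (h v) p in proj₂ (free-split-at-zero u v pos) (a , x , b) }))))
          (∑□-*ˡ (stairs L E) (𝟙 (free? u)) (𝟙 ∘ P?))

  tails-run : ∀ M r rest {P : List ℕ → Set} (P? : ∀ v → Dec (P v)) → 0 < M → All (M ≤_) rest →
    (∀ v → (AcrossZero (replicate r M ++ rest) v × Free v) ⇔ P v) →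
    tails (replicate r M ++ rest) ≡ 𝟙 (free? rest) * ∑□ (stairs L E) (𝟙 ∘ P?)
  tails-run M r rest P? 0<M M≤rest h =
    trans (tails-factor (replicate r M ++ rest) P? (All.map (<-≤-trans 0<M) (replicate-++-≥ M r rest M≤rest)) h)
          (cong (_* _) (𝟙-cong (free? (replicate r M ++ rest)) (free? rest) (free-run-++ M r rest M≤rest)))

  ∑□-run : ∀ M r {Rest : List ℕ → Set} (Rest? : ∀ w → Dec (Rest w)) c → M < K → r ≤ suc q →
    (∀ rest → Rest rest → tails (replicate r M ++ rest) ≡ 𝟙 (free? rest) * c) →
    ∑□ (stairs (suc q) K) (λ u → 𝟙 (runThen? M r Rest? u) * tails u)
      ≡ ∑□ (stairs (suc q ∸ r) (r + K)) (λ rest → 𝟙 (Rest? rest ×-dec free? rest)) * c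
  ∑□-run M r {Rest} Rest? c M<K r≤ h = begin
    ∑□ (stairs (suc q) K) F
      ≡⟨ ∑□-stairs-split r (suc q) K F r≤ ⟩
    ∑□ (stairs r K) (λ u₁ → ∑□ tailBox (λ u₂ → F (u₁ ++ u₂)))
      ≡⟨ ∑□-single (stairs r K) t (inBox-replicate-stairs r M K M<K) notRun ⟩
    ∑□ tailBox (λ u₂ → F (t ++ u₂))
      ≡⟨ ∑□-cong tailBox (λ u₂ _ → afterRun u₂) ⟩
    ∑□ tailBox (λ u₂ → 𝟙 (Rest? u₂ ×-dec free? u₂) * c)
      ≡⟨ ∑□-*ʳ tailBox _ c ⟩
    ∑□ tailBox (λ u₂ → 𝟙 (Rest? u₂ ×-dec free? u₂)) * c ∎
    where
    open ≡-Reasoning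
    t = replicate r M
    tailBox = stairs (suc q ∸ r) (r + K)
    F : List ℕ → ℕ
    F u = 𝟙 (runThen? M r Rest? u) * tails u
    notRun : ∀ u₁ → InBox u₁ (stairs r K) → u₁ ≢ t → ∑□ tailBox (λ u₂ → F (u₁ ++ u₂)) ≡ 0
    notRun u₁ u₁∈ u₁≢t = ∑□-zero tailBox (λ u₂ _ → cong (_* tails (u₁ ++ u₂)) (𝟙-no (runThen? M r Rest? (u₁ ++ u₂))
      (λ (taken , _) → u₁≢t (trans (sym (proj₁ (take-drop-++ u₁ u₂ (trans (Pointwise-length u₁∈) (length-stairs r K))))) taken))))
    afterRun : ∀ u₂ → F (t ++ u₂) ≡ 𝟙 (Rest? u₂ ×-dec free? u₂) * c
    afterRun u₂ = begin
      𝟙 (runThen? M r Rest? (t ++ u₂)) * tails (t ++ u₂)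
        ≡⟨ cong (_* tails (t ++ u₂)) (𝟙-cong (runThen? M r Rest? (t ++ u₂)) (Rest? u₂)
             ((λ (_ , p) → subst Rest (proj₂ (take-drop-++ t u₂ (length-replicate r))) p) , runThen-++ M r {Rest} u₂)) ⟩
      𝟙 (Rest? u₂) * tails (t ++ u₂)                        ≡⟨ 𝟙-guard (Rest? u₂) (h u₂) ⟩
      𝟙 (Rest? u₂) * (𝟙 (free? u₂) * c)                    ≡⟨ sym (*-assoc (𝟙 (Rest? u₂)) _ c) ⟩
      𝟙 (Rest? u₂) * 𝟙 (free? u₂) * c                      ≡⟨ cong (_* c) (sym (𝟙-× (Rest? u₂ ×-dec free? u₂) (Rest? u₂) (free? u₂) (id , id))) ⟩
      𝟙 (Rest? u₂ ×-dec free? u₂) * c                      ∎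

  module _ (m : ℕ) (m<s : m < s) where
    private
      M : ℕ
      M = suc m
      M<K : M < K
      M<K = s<s m<s
      M<E : M < E
      M<E = ≤-trans M<K s<E

    count-allMin : ∑□ (stairs (suc q) K) (λ u → 𝟙 (hasShape? M allMin u) * tails u) ≡ γ L M
    count-allMin = begin
      ∑□ (stairs (suc q) K) (λ u → 𝟙 (hasShape? M allMin u) * tails u)
        ≡⟨ ∑□-run M (suc q) (rest? M allMin) (γ L M) M<K ≤-refl tails-allMin ⟩
      ∑□ (stairs (suc q ∸ suc q) (suc q + K)) (λ rest → 𝟙 (rest? M allMin rest ×-dec free? rest)) * γ L M
        ≡⟨ cong (λ n → ∑□ (stairs n (suc q + K)) (λ rest → 𝟙 (rest? M allMin rest ×-dec free? rest)) * γ L M) (n∸n≡0 q) ⟩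
      1 * γ L M
        ≡⟨ *-identityˡ _ ⟩
      γ L M ∎
      where
      open ≡-Reasoning
      tails-allMin : ∀ rest → rest ≡ [] → tails (replicate (suc q) M ++ rest) ≡ 𝟙 (free? rest) * γ L M
      tails-allMin .[] refl =
        trans (tails-run M (suc q) [] _ z<s []
                 (tailCondition-allMin M q))
              (cong (1 *_) (∑□-within-uniqueBelow L E m M<E))

    count-minThenAbove : ∀ r → r < q →
      ∑□ (stairs (suc q) K) (λ u → 𝟙 (hasShape? M (minThenAbove r) u) * tails u) ≡ α (q ∸ r) (suc r + K ∸ suc M) * β L M
    count-minThenAbove r r<q =
      trans (∑□-run M (suc r) (allAbove? M) (β L M) M<K (s≤s (<⇒≤ r<q)) tails-minThenAbove)
            (cong (_* β L M) (∑□-allAbove (q ∸ r) (suc r + K) M (m<n⇒0<n∸m r<q) (≤-trans M<K (m≤n+m K (suc r)))))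
      where
      tails-minThenAbove : ∀ rest → AllAbove M rest → tails (replicate (suc r) M ++ rest) ≡ 𝟙 (free? rest) * β L M
      tails-minThenAbove (y ∷ rest) M<u =
        trans (tails-run M (suc r) (y ∷ rest) _ z<s (All.map <⇒≤ M<u) (λ v → tailCondition-minThenAbove M r y rest v M<u))
              (cong (𝟙 (free? (y ∷ rest)) *_) (∑□-within-distinct L E M M<E))

    count-minReturns : ∀ r → r ≤ q →
      ∑□ (stairs (suc q) K) (λ u → 𝟙 (hasShape? M (minReturns r) u) * tails u) ≡ α′ (suc q ∸ r) (r + K ∸ M) * β L m
    count-minReturns r r≤q =
      trans (∑□-run M r (aboveThenMin? M) (β L m) M<K (m≤n⇒m≤1+n r≤q) tails-minReturns)
            (cong (_* β L m) (∑□-aboveThenMin (suc q ∸ r) (r + K) M (≤-trans (<⇒≤ M<K) (m≤n+m K r))))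
      where
      tails-minReturns : ∀ rest → AboveThenMin M rest → tails (replicate r M ++ rest) ≡ 𝟙 (free? rest) * β L m
      tails-minReturns (y ∷ rest) (M<y , M≤rest , M∈rest) =
        trans (tails-run M r (y ∷ rest) _ z<s (<⇒≤ M<y ∷ M≤rest) (λ v → tailCondition-minReturns m r y rest v M<y M≤rest M∈rest))
              (cong (𝟙 (free? (y ∷ rest)) *_) (∑□-within-distinct L E m (<-trans (n<1+n m) M<E)))

  ShapeTerm : ℕ → ℕ
  ShapeTerm m = γ L (suc m)
    + ∑< q (λ r → α (q ∸ r) (suc r + K ∸ suc (suc m)) * β L (suc m))
    + ∑< (suc q) (λ r → α′ (suc q ∸ r) (r + K ∸ suc m) * β L m)

  ∑□-positive-by-shape : ∑□ (stairs (suc q) K) (λ u → 𝟙 (positive? u) * tails u) ≡ ∑< s ShapeTerm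
  ∑□-positive-by-shape = begin
    ∑□ box (λ u → 𝟙 (positive? u) * tails u)
      ≡⟨ ∑□-cong box (λ u u∈ → 𝟙-positive-by-shape s u (tails u) u∈) ⟩
    ∑□ box (λ u → ∑< s (λ m → shapeIndicators (suc m) u (tails u)))
      ≡⟨ ∑□-∑< box s (λ m u → shapeIndicators (suc m) u (tails u)) ⟩
    ∑< s (λ m → ∑□ box (λ u → shapeIndicators (suc m) u (tails u)))
      ≡⟨ ∑<-cong s (λ m m<s → byShape m m<s) ⟩
    ∑< s ShapeTerm ∎
    where
    open ≡-Reasoning
    box = stairs (suc q) K
    byShape : ∀ m → m < s → ∑□ box (λ u → shapeIndicators (suc m) u (tails u)) ≡ ShapeTerm m
    byShape m m<s = begin
      ∑□ box (λ u → A u + B u + C u)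
        ≡⟨ trans (∑□-distrib-+ box (λ u → A u + B u) C) (cong (_+ ∑□ box C) (∑□-distrib-+ box A B)) ⟩
      ∑□ box A + ∑□ box B + ∑□ box C
        ≡⟨ cong₂ _+_ (cong₂ _+_ (count-allMin m m<s)
                                (trans (∑□-∑< box q (λ r u → 𝟙 (hasShape? (suc m) (minThenAbove r) u) * tails u))
                                       (∑<-cong q (count-minThenAbove m m<s))))
                     (trans (∑□-∑< box (suc q) (λ r u → 𝟙 (hasShape? (suc m) (minReturns r) u) * tails u))
                            (∑<-cong (suc q) (λ r r<1+q → count-minReturns m m<s r (≤-pred r<1+q)))) ⟩
      ShapeTerm m ∎
      where
      A B C : List ℕ → ℕ
      A u = 𝟙 (hasShape? (suc m) allMin u) * tails u
      B u = ∑< q (λ r → 𝟙 (hasShape? (suc m) (minThenAbove r) u) * tails u)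
      C u = ∑< (suc q) (λ r → 𝟙 (hasShape? (suc m) (minReturns r) u) * tails u)

n<2+n+m : ∀ n m → n < 2 + n + m
n<2+n+m n m = ≤-trans (n≤1+n (suc n)) (m≤m+n (2 + n) m)

-- Words of size n + 1 and shift s whose first zero is at position q + 2 and whose prefix has minimum m + 1.
ShapeTerm′ : ℕ → ℕ → ℕ → ℕ → ℕ
ShapeTerm′ n s q = PrefixCounts.ShapeTerm s q (n ∸ suc q) (2 + s + suc q) (n<2+n+m s (suc q))

α′-by-shapes : ∀ n s → α′ (suc n) (suc s) ≡ ∑< n (λ q → ∑< s (ShapeTerm′ n s q))
α′-by-shapes n s =
  trans (α′-by-first-zero n s)
        (∑<-cong n (λ q _ → PrefixCounts.∑□-positive-by-shape s q (n ∸ suc q) (2 + s + suc q) (n<2+n+m s (suc q))))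

-- Imported only here: in scope, Data.Integer's prefix +_ makes sections such as (c +_) ambiguous.
open import Data.Integer as ℤ using (ℤ; +_)
import Data.Integer.Properties as ℤ

applyUpTo-stairs : ∀ n K (f : ℕ → ℕ) → (∀ j → f j ≡ j + K) → applyUpTo f n ≡ stairs n K
applyUpTo-stairs zero    K f h = refl
applyUpTo-stairs (suc n) K f h =
  cong₂ _∷_ (h 0) (applyUpTo-stairs n (suc K) (f ∘ suc) (λ j → trans (h (suc j)) (sym (+-suc j K))))

applyUpTo-const : ∀ n (k : ℕ) → applyUpTo (λ _ → k) n ≡ replicate n k
applyUpTo-const zero    k = refl
applyUpTo-const (suc n) k = cong (k ∷_) (applyUpTo-const n k)

shiftedBound-stairs : ∀ t K → t ℤ.+ + 1 ≡ + K → ∀ j → shiftedBound t j ≡ j + K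
shiftedBound-stairs t K t+1≡K j = cong clamp (begin
  + suc j ℤ.+ t          ≡⟨ cong (ℤ._+ t) (cong +_ (+-comm 1 j)) ⟩
  (+ j ℤ.+ + 1) ℤ.+ t    ≡⟨ ℤ.+-assoc (+ j) (+ 1) t ⟩
  + j ℤ.+ (+ 1 ℤ.+ t)    ≡⟨ cong (λ u → + j ℤ.+ u) (ℤ.+-comm (+ 1) t) ⟩
  + j ℤ.+ (t ℤ.+ + 1)    ≡⟨ cong (λ u → + j ℤ.+ u) t+1≡K ⟩
  + (j + K)              ∎)
  where open ≡-Reasoning

𝔞≡α : ∀ n t K → t ℤ.+ + 1 ≡ + K → 𝔞 n t ≡ α n K
𝔞≡α n t K t+1≡K =
  trans (count-seqs n (shiftedBound t) avoids100-102? free? avoids100-102⇔)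
        (cong (λ bs → ∑□ bs (𝟙 ∘ free?)) (applyUpTo-stairs n K _ (shiftedBound-stairs t K t+1≡K)))

𝔞′≡α′ : ∀ n t K → t ℤ.+ + 1 ≡ + K → 𝔞′ n t ≡ α′ n K
𝔞′≡α′ n t K t+1≡K =
  trans (count-seqs n (shiftedBound t) _ (λ w → free? w ×-dec primed? w) (λ σ → avoids100-102⇔ σ ×-⇔ prime′⇔ σ))
        (cong (λ bs → ∑□ bs (λ w → 𝟙 (free? w ×-dec primed? w))) (applyUpTo-stairs n K _ (shiftedBound-stairs t K t+1≡K)))

𝔟≡β : ∀ n k → 𝔟 n k ≡ β n k
𝔟≡β n k =
  trans (count-seqs n (λ _ → k) _ (λ w → free102? w ×-dec distinct? w) (λ σ → avoids102⇔ σ ×-⇔ allDistinct⇔ σ))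
        (cong (λ bs → ∑□ bs _) (applyUpTo-const n k))

𝔠≡γ : ∀ n k → 𝔠 n k ≡ γ n k
𝔠≡γ n k =
  trans (count-seqs n (λ _ → k) _ (λ w → free102? w ×-dec uniqueOn? (λ x → ¬? (x ≟ k ∸ 1)) w)
                    (λ σ → avoids102⇔ σ ×-⇔ distinctExceptTop⇔ k σ))
        (cong (λ bs → ∑□ bs _) (applyUpTo-const n k))

sumFT≡∑< : ∀ a b f → sumFT a b f ≡ ∑< (suc b ∸ a) (λ k → f (a + k))
sumFT≡∑< a b f = sum-applyUpTo (λ k → f (a + k)) (suc b ∸ a)

[i-j]+j≡i : ∀ (i j : ℤ) → (i ℤ.- j) ℤ.+ j ≡ i
[i-j]+j≡i i j = trans (ℤ.+-assoc i (ℤ.- j) j) (trans (cong (λ u → i ℤ.+ u) (ℤ.+-inverseˡ j)) (ℤ.+-identityʳ i))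

+a-+b≡+[a∸b] : ∀ a b → b ≤ a → + a ℤ.- + b ≡ + (a ∸ b)
+a-+b≡+[a∸b] a b b≤a = trans (ℤ.m-n≡m⊖n a b) (ℤ.⊖-≥ b≤a)

+[a-b]+1≡+[1+a∸b] : ∀ a b → b ≤ a → (+ a ℤ.- + b) ℤ.+ + 1 ≡ + (suc a ∸ b)
+[a-b]+1≡+[1+a∸b] a b b≤a =
  trans (cong (ℤ._+ + 1) (+a-+b≡+[a∸b] a b b≤a))
        (cong +_ (trans (+-comm (a ∸ b) 1) (sym (+-∸-assoc 1 b≤a))))

summand : ℕ → ℕ → ℕ → ℕ → ℕ
summand n s p m = 𝔠 (n ∸ p) m
  + sumFT 1 (p ∸ 2) (λ r → 𝔞 (p ∸ 1 ∸ r) (+ s ℤ.+ + r ℤ.- + m ℤ.- + 1) * 𝔟 (n ∸ p) m)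
  + sumFT 0 (p ∸ 2) (λ r → 𝔞′ (p ∸ 1 ∸ r) (+ s ℤ.+ + r ℤ.- + m) * 𝔟 (n ∸ p) (m ∸ 1))

shapeTerm≡summand : ∀ n s q m → m < s → ShapeTerm′ n s q m ≡ summand (suc n) s (2 + q) (suc m)
shapeTerm≡summand n s q m m<s = cong₂ _+_ (cong₂ _+_ (sym (𝔠≡γ L (suc m))) aboveTerms) returnTerms
  where
  L = n ∸ suc q
  1+s+r : ∀ r → suc (s + r) ≡ r + suc s
  1+s+r r = trans (cong suc (+-comm s r)) (sym (+-suc r s))
  aboveSummand returnSummand : ℕ → ℕ
  aboveSummand r  = 𝔞 (suc q ∸ r) (+ s ℤ.+ + r ℤ.- + suc m ℤ.- + 1) * 𝔟 L (suc m)
  returnSummand r = 𝔞′ (suc q ∸ r) (+ s ℤ.+ + r ℤ.- + suc m) * 𝔟 L m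
  aboveTerms : ∑< q (λ r → α (q ∸ r) (suc r + suc s ∸ suc (suc m)) * β L (suc m)) ≡ sumFT 1 q aboveSummand
  aboveTerms = trans (∑<-cong q {g = aboveSummand ∘ suc} (λ r _ →
                       cong₂ _*_ (sym (𝔞≡α (q ∸ r) (+ s ℤ.+ + suc r ℤ.- + suc m ℤ.- + 1) _ (shift r))) (sym (𝔟≡β L (suc m)))))
                     (sym (sumFT≡∑< 1 q aboveSummand))
    where
    shift : ∀ r → (+ s ℤ.+ + suc r ℤ.- + suc m ℤ.- + 1) ℤ.+ + 1 ≡ + (suc r + suc s ∸ suc (suc m))
    shift r = trans ([i-j]+j≡i _ (+ 1))
                    (trans (+a-+b≡+[a∸b] (s + suc r) (suc m) (≤-trans m<s (m≤m+n s (suc r))))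
                           (cong (λ k → + (k ∸ suc m)) (trans (+-suc s r) (1+s+r r))))
  returnTerms : ∑< (suc q) (λ r → α′ (suc q ∸ r) (r + suc s ∸ suc m) * β L m) ≡ sumFT 0 q returnSummand
  returnTerms = trans (∑<-cong (suc q) {g = returnSummand} (λ r _ →
                        cong₂ _*_ (sym (𝔞′≡α′ (suc q ∸ r) (+ s ℤ.+ + r ℤ.- + suc m) _ (shift r))) (sym (𝔟≡β L m))))
                      (sym (sumFT≡∑< 0 q returnSummand))
    where
    shift : ∀ r → (+ s ℤ.+ + r ℤ.- + suc m) ℤ.+ + 1 ≡ + (r + suc s ∸ suc m)
    shift r = trans (+[a-b]+1≡+[1+a∸b] (s + r) (suc m) (≤-trans m<s (m≤m+n s r)))
                    (cong (λ k → + (k ∸ suc m)) (1+s+r r))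

shapeTerms≡summands : ∀ n s →
  ∑< n (λ q → ∑< s (ShapeTerm′ n s q)) ≡ sumFT 2 (suc n) (λ p → sumFT 1 s (summand (suc n) s p))
shapeTerms≡summands n s =
  trans (∑<-cong n (λ q _ → trans (∑<-cong s (shapeTerm≡summand n s q)) (sym (sumFT≡∑< 1 s (summand (suc n) s (2 + q))))))
        (sym (sumFT≡∑< 2 (suc n) (λ p → sumFT 1 s (summand (suc n) s p))))

𝔞[s]≡α : ∀ n s → 𝔞 n (+ s) ≡ α n (suc s)
𝔞[s]≡α n s = 𝔞≡α n (+ s) (suc s) (cong +_ (+-comm s 1))

𝔞[s-1]≡α : ∀ n s → 𝔞 n (+ s ℤ.- + 1) ≡ α n s
𝔞[s-1]≡α n s = 𝔞≡α n (+ s ℤ.- + 1) s ([i-j]+j≡i (+ s) (+ 1))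

𝔞[s+1]≡α : ∀ n s → 𝔞 n (+ s ℤ.+ + 1) ≡ α n (2 + s)
𝔞[s+1]≡α n s = 𝔞≡α n (+ s ℤ.+ + 1) (2 + s) (cong +_ (trans (+-assoc s 1 1) (+-comm s 2)))

𝔞′[s]≡α′ : ∀ n s → 𝔞′ n (+ s) ≡ α′ n (suc s)
𝔞′[s]≡α′ n s = 𝔞′≡α′ n (+ s) (suc s) (cong +_ (+-comm s 1))

theorem23 : (n s : ℕ) → 1 ≤ n →
    (𝔞 n (+ s) ≡ 𝔞 n (+ s ℤ.- + 1) + 𝔞 (n ∸ 1) (+ s ℤ.+ + 1) + 𝔞′ n (+ s))
    × (𝔞′ n (+ s) ≡ sumFT 2 n (λ p → sumFT 1 s (λ m →
          𝔠 (n ∸ p) m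
          + sumFT 1 (p ∸ 2) (λ r → 𝔞 (p ∸ 1 ∸ r) (+ s ℤ.+ + r ℤ.- + m ℤ.- + 1) * 𝔟 (n ∸ p) m)
          + sumFT 0 (p ∸ 2) (λ r → 𝔞′ (p ∸ 1 ∸ r) (+ s ℤ.+ + r ℤ.- + m) * 𝔟 (n ∸ p) (m ∸ 1)))))
theorem23 (suc n) s _ = first , second
  where
  open ≡-Reasoning
  first : 𝔞 (suc n) (+ s) ≡ 𝔞 (suc n) (+ s ℤ.- + 1) + 𝔞 n (+ s ℤ.+ + 1) + 𝔞′ (suc n) (+ s)
  first = begin
    𝔞 (suc n) (+ s)                                ≡⟨ 𝔞[s]≡α (suc n) s ⟩
    α (suc n) (suc s)                              ≡⟨ α-recurrence n s ⟩
    α (suc n) s + α n (2 + s) + α′ (suc n) (suc s) ≡⟨ sym (cong₂ _+_ (cong₂ _+_ (𝔞[s-1]≡α (suc n) s) (𝔞[s+1]≡α n s))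
                                                                      (𝔞′[s]≡α′ (suc n) s)) ⟩
    𝔞 (suc n) (+ s ℤ.- + 1) + 𝔞 n (+ s ℤ.+ + 1) + 𝔞′ (suc n) (+ s) ∎
  second : 𝔞′ (suc n) (+ s) ≡ sumFT 2 (suc n) (λ p → sumFT 1 s (summand (suc n) s p))
  second = begin
    𝔞′ (suc n) (+ s)                                        ≡⟨ 𝔞′[s]≡α′ (suc n) s ⟩
    α′ (suc n) (suc s)                                      ≡⟨ α′-by-shapes n s ⟩
    ∑< n (λ q → ∑< s (ShapeTerm′ n s q))                    ≡⟨ shapeTerms≡summands n s ⟩
    sumFT 2 (suc n) (λ p → sumFT 1 s (summand (suc n) s p)) ∎
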